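{- Let $p$ be a prime, let $G$ be a connected graph, let $V$ be a set of marked vertices of $G$, and suppose $c\in V$ is 2-valent in $G$. Suppose $P_1,\ldots,P_{p-1}$ are bipartitions of $V$ such that every part of every $P_j$ contains at least one vertex of $V\setminus\{c\}$. Then for any index $i$ there is a partition of \[ \mathcal{G}_{P_1,\ldots,P_i,\ldots,P_{p-1}} \cup \mathcal{G}_{P_1,\ldots,P_i^{c},\ldots,P_{p-1}} \] into subsets (orbits) each of whose sizes is divisible by $p$, where $P_i^c$ is the bipartition of $V$ obtained from $P_i$ by moving $c$ to the other part, and all $P_j$ with $j\neq i$ are unchanged. Consequently \[ g_{P_1,\ldots,P_i,\ldots,P_{p-1}} + g_{P_1,\ldots,P_i^{c},\ldots,P_{p-1}} \equiv 0 \pmod p. \]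
   Context: A spanning 2-forest is a spanning forest with exactly two trees; it is compatible with a bipartition $A\cup B$ of $V$ if one tree contains all of $A$ and none of $B$ and the other contains all of $B$ and none of $A$. Let $G^{(p-1)}$ be the multigraph with $p-1$ copies of each edge of $G$. For bipartitions $P_1,\ldots,P_{p-1}$ of $V$, $\mathcal{G}_{P_1,\ldots,P_{p-1}}$ is the set of ordered partitions $(\psi_1,\ldots,\psi_{p-1},\phi_1,\ldots,\phi_{p-1})$ of the edges of $G^{(p-1)}$ (copies of an edge not distinguished; i.e. ordered tuples of subgraphs of $G$ in which every edge of $G$ lies in exactly $p-1$ of the subgraphs) such that each $\psi_j$ is a spanning tree of $G$ and each $\phi_j$ is a spanning 2-forest of $G$ compatible with $P_j$; $g_{P_1,\ldots,P_{p-1}}$ is its cardinality. -}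

module Defs where

open import Data.Nat using (ℕ; _∸_; _+_)
open import Data.Nat.Divisibility using (_∣_)
open import Data.Bool using (Bool; true; false; not; if_then_else_)
open import Data.Fin using (Fin; _≟_)
open import Data.Fin.Subset using (Subset; ⊤)
open import Data.Vec using (Vec; lookup; tabulate; map; sum; _[_]%=_; _[_]≔_)
open import Data.List using (List; []; _∷_; concat; length)
open import Data.List.Membership.Propositional using (_∈_)
open import Data.List.Relation.Unary.Unique.Propositional using (Unique)
open import Data.List.Relation.Unary.All using (All)
open import Data.Product using (Σ; ∃; ∃-syntax; _×_; _,_; proj₁; proj₂)
open import Data.Sum using (_⊎_)
open import Relation.Nullary using (¬_; does)
open import Relation.Binary.PropositionalEquality using (_≡_; _≢_)

record Graph : Set where
  field
    n    : ℕ
    m    : ℕ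
    ends : Fin m → Fin n × Fin n
open Graph public

module _ (G : Graph) where

  InE : Fin (m G) → Subset (m G) → Set
  InE e S = lookup S e ≡ true

  Joins : Fin (m G) → Fin (n G) → Fin (n G) → Set
  Joins e u w = ends G e ≡ (u , w) ⊎ ends G e ≡ (w , u)

  data Walk (S : Subset (m G)) : Fin (n G) → Fin (n G) → List (Fin (m G)) → Set where
    here : ∀ {v} → Walk S v v []
    step : ∀ {u w v es} (e : Fin (m G)) → InE e S → Joins e u w →
           Walk S w v es → Walk S u v (e ∷ es)

  Conn : Subset (m G) → Fin (n G) → Fin (n G) → Set
  Conn S u v = ∃[ es ] Walk S u v es

  Connected : Subset (m G) → Set
  Connected S = ∀ u v → Conn S u v

  -- acyclic: no nonempty closed trail (closed walk with pairwise distinct edges)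
  Acyclic : Subset (m G) → Set
  Acyclic S = ∀ v es → Walk S v v es → Unique es → es ≡ []

  SpanningTree : Subset (m G) → Set
  SpanningTree S = Connected S × Acyclic S

  Spanning2Forest : Subset (m G) → Set
  Spanning2Forest S = Acyclic S ×
    (∃[ x ] ∃[ y ] (¬ Conn S x y × (∀ z → Conn S z x ⊎ Conn S z y)))

  -- degree of a vertex (a loop counts twice)
  bit : Bool → ℕ
  bit true = 1
  bit false = 0

  degree : Fin (n G) → ℕ
  degree c = sum (tabulate (λ e → bit (does (proj₁ (ends G e) ≟ c)) + bit (does (proj₂ (ends G e) ≟ c))))

  -- A bipartition of the marked set V is given by a side-subset P:
  -- part A = V ∩ P, part B = V ∖ P.
  InA : Subset (n G) → Subset (n G) → Fin (n G) → Set
  InA V P v = lookup V v ≡ true × lookup P v ≡ true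

  InB : Subset (n G) → Subset (n G) → Fin (n G) → Set
  InB V P v = lookup V v ≡ true × lookup P v ≡ false

  Compatible : Subset (n G) → Subset (n G) → Subset (m G) → Set
  Compatible V P S =
    (∀ a a' → InA V P a → InA V P a' → Conn S a a') ×
    (∀ b b' → InB V P b → InB V P b' → Conn S b b') ×
    (∀ a b → InA V P a → InB V P b → ¬ Conn S a b)

  flipAt : Fin (n G) → Subset (n G) → Subset (n G)
  flipAt c P = P [ c ]%= not

  mult : ∀ {k} → Fin (m G) → Vec (Subset (m G)) k → ℕ
  mult e Ss = sum (map (λ S → bit (lookup S e)) Ss)

  Conf : ℕ → Set
  Conf p = Vec (Subset (m G)) (p ∸ 1) × Vec (Subset (m G)) (p ∸ 1)

  InGP : (p : ℕ) → Subset (n G) → Vec (Subset (n G)) (p ∸ 1) → Conf p → Set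
  InGP p V Ps (ψ , φ) =
    (∀ e → mult e ψ + mult e φ ≡ p ∸ 1) ×
    (∀ j → SpanningTree (lookup ψ j)) ×
    (∀ j → Spanning2Forest (lookup φ j) × Compatible V (lookup Ps j) (lookup φ j))

HasSize : {A : Set} → (A → Set) → ℕ → Set
HasSize {A} Q k = Σ (List A) λ xs → Unique xs × length xs ≡ k × (∀ t → (t ∈ xs → Q t) × (Q t → t ∈ xs))

PartitionDivBy : {A : Set} → ℕ → (A → Set) → Set
PartitionDivBy {A} p Q = Σ (List (List A)) λ blocks →
  Unique (concat blocks) ×
  (∀ t → (t ∈ concat blocks → Q t) × (Q t → t ∈ concat blocks)) ×
  All (λ b → b ≢ [] × p ∣ length b) blocks

-- A loop at c lies in no acyclic subgraph, so then both sets are empty. Otherwise c has two pendant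
-- edges e₁, e₂ and no other edge meets c. Every subgraph of a configuration in either set must reach c,
-- and e₁, e₂ each occur p - 1 times among the 2(p - 1) subgraphs, so each subgraph contains exactly one
-- of them. Erasing e₁, e₂ therefore leaves a base configuration, and recording which of the two each
-- subgraph used leaves a word with p - 1 letters true; the configuration is recovered from the pair.
-- Exchanging e₁ and e₂ preserves spanning trees, and in the i-th slot it turns a forest compatible with
-- P_i into one compatible with P_i^c and vice versa. Hence for a fixed base at least p letters of the
-- word are unconstrained, and the number of admissible words is a binomial coefficient C(f, p - 1 - s)
-- with p ≤ f and f + s ≤ 2(p - 1), which p divides. The configurations sharing a base form the blocks.

module Submission where

open import Defs

open import Data.Bool using (Bool; true; false; not; T; T?; _∧_; if_then_else_)
import Data.Bool.Properties as Boolₚ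
open import Data.Empty using (⊥; ⊥-elim)
open import Data.Fin as Fin using (Fin; _≟_)
import Data.Fin.Properties as Finₚ
open import Data.Fin.Subset using (Subset; ⊤)
open import Data.List as List using (List; []; _∷_; cartesianProductWith; allFin)
import Data.List.Properties as Listₚ
open import Data.List.Membership.Propositional using (_∈_)
open import Data.List.Membership.Propositional.Properties
  using (∈-cartesianProductWith⁺; ∈-cartesianProduct⁺; ∈-allFin; ∈-concatMap⁺; ∈-map⁺; ∈-map⁻; ∈-lookup;
         ∈-filter⁺; ∈-filter⁻; ∈-concat⁺′; ∈-concat⁻′)
open import Data.List.Relation.Binary.Disjoint.Propositional using (Disjoint)
open import Data.List.Relation.Unary.All as ListAll using ([]; _∷_)
import Data.List.Relation.Unary.All.Properties as ListAllₚ
open import Data.List.Relation.Unary.AllPairs as AllPairs using ([]; _∷_)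
import Data.List.Relation.Unary.AllPairs.Properties as AllPairsₚ
open import Data.List.Relation.Unary.Any as Any using (here; there)
open import Data.List.Relation.Unary.Unique.Propositional using (Unique)
import Data.List.Relation.Unary.Unique.Propositional.Properties as Uniqueₚ
open import Data.Nat using (ℕ; zero; suc; _+_; _*_; _∸_; _≤_; _<_; z≤n; s≤s; _≤?_; _≡ᵇ_)
open import Data.Nat.Combinatorics using (_C_; nCk+nC[k+1]≡[n+1]C[k+1]; nC1≡n)
open import Data.Nat.Divisibility using (_∣_; divides; _∣0; ∣m∣n⇒∣m+n; ∣⇒≤)
import Data.Nat.ListAction as ListSum
open import Data.Nat.Primality using (Prime; euclidsLemma)
open import Data.Nat.Properties as ℕₚ
  using (+-identityʳ; *-zeroʳ; *-identityˡ; *-identityʳ; *-distribˡ-+; +-assoc; +-comm; *-comm; +-suc;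
         <⇒≱; <-trans; n<1+n; ≰⇒>; m+[n∸m]≡n; m∸n≤m; m+n≤o⇒m≤o∸n; m≤n⇒m≤1+n; suc-injective; <-irrefl;
         +-mono-≤; +-monoʳ-≤; +-cancelˡ-≤; +-cancelʳ-≤; +-cancelˡ-≡; ≤-antisym; ≤-trans; ≤-reflexive;
         ≡ᵇ⇒≡; ≡⇒≡ᵇ; +-commutativeSemigroup; module ≤-Reasoning)
open import Algebra.Properties.CommutativeSemigroup +-commutativeSemigroup using () renaming (interchange to +-interchange)
open import Data.Product using (_×_; _,_; proj₁; proj₂; ∃-syntax; uncurry)
import Data.Product.Properties as ×ₚ
open import Data.Sum as Sum using (_⊎_; inj₁; inj₂)
open import Data.Vec as Vec using (Vec; []; _∷_; _++_; lookup; _[_]≔_)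
import Data.Vec.Properties as Vecₚ
open import Data.Vec.Relation.Binary.Pointwise.Extensional using (ext; Pointwise-≡⇒≡)
open import Data.Vec.Relation.Unary.All using (All; []; _∷_; all?)
open import Function using (_∘_; case_of_)
open import Function.Bundles using (_⇔_; mk⇔; Equivalence)
open import Relation.Binary.PropositionalEquality
open import Relation.Nullary using (¬_; Dec; yes; no)
open import Relation.Nullary.Decidable
  using (does; isYes; isYes≗does; does-⇔; toWitness; fromWitness; map′; _×-dec_; _⊎-dec_; _→-dec_; ¬?)
open import Relation.Unary using (Decidable)

-- Binomial coefficients modulo a prime

[k+1]*[n+1]C[k+1]≡[n+1]*nCk : ∀ n k → suc k * (suc n C suc k) ≡ suc n * (n C k)
[k+1]*[n+1]C[k+1]≡[n+1]*nCk zero zero = refl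
[k+1]*[n+1]C[k+1]≡[n+1]*nCk zero (suc k) = *-zeroʳ (suc (suc k))
[k+1]*[n+1]C[k+1]≡[n+1]*nCk (suc n) zero = begin
  1 * (suc (suc n) C 1) ≡⟨ *-identityˡ _ ⟩
  suc (suc n) C 1       ≡⟨ nC1≡n (suc (suc n)) ⟩
  suc (suc n)           ≡⟨ *-identityʳ _ ⟨
  suc (suc n) * 1       ∎
  where open ≡-Reasoning
[k+1]*[n+1]C[k+1]≡[n+1]*nCk (suc n) (suc k) = begin
  suc (suc k) * (suc (suc n) C suc (suc k))
    ≡⟨ cong (suc (suc k) *_) (nCk+nC[k+1]≡[n+1]C[k+1] (suc n) (suc k)) ⟨
  suc (suc k) * (suc n C suc k + suc n C suc (suc k))
    ≡⟨ *-distribˡ-+ (suc (suc k)) (suc n C suc k) _ ⟩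
  suc (suc k) * (suc n C suc k) + suc (suc k) * (suc n C suc (suc k))
    ≡⟨ cong (suc (suc k) * (suc n C suc k) +_) ([k+1]*[n+1]C[k+1]≡[n+1]*nCk n (suc k)) ⟩
  (suc n C suc k + suc k * (suc n C suc k)) + suc n * (n C suc k)
    ≡⟨ cong (λ z → (suc n C suc k + z) + suc n * (n C suc k)) ([k+1]*[n+1]C[k+1]≡[n+1]*nCk n k) ⟩
  (suc n C suc k + suc n * (n C k)) + suc n * (n C suc k)
    ≡⟨ +-assoc (suc n C suc k) _ _ ⟩
  suc n C suc k + (suc n * (n C k) + suc n * (n C suc k))
    ≡⟨ cong (suc n C suc k +_) (*-distribˡ-+ (suc n) (n C k) _) ⟨
  suc n C suc k + suc n * (n C k + n C suc k)
    ≡⟨ cong (λ z → suc n C suc k + suc n * z) (nCk+nC[k+1]≡[n+1]C[k+1] n k) ⟩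
  suc (suc n) * (suc n C suc k) ∎
  where open ≡-Reasoning

-- The case d = 0 is Euclid's lemma applied to k * (p C k) = p * ((p - 1) C (k - 1)); Pascal's rule then raises d.
p∣[p+d]Ck : ∀ {p} → Prime p → ∀ {d k} → d < k → k < p → p ∣ (p + d) C k
p∣[p+d]Ck {suc n} pp {zero} {suc k} d<k k<p
  rewrite +-identityʳ n
  with euclidsLemma (suc k) (suc n C suc k) pp
         (divides (n C k) (trans ([k+1]*[n+1]C[k+1]≡[n+1]*nCk n k) (*-comm (suc n) (n C k))))
... | inj₁ p∣k = ⊥-elim (<⇒≱ k<p (∣⇒≤ p∣k))
... | inj₂ p∣C = p∣C
p∣[p+d]Ck {suc n} pp {suc d} {suc k} (s≤s d<k) k<p
  rewrite +-suc n d
  = subst (suc n ∣_) (nCk+nC[k+1]≡[n+1]C[k+1] (suc n + d) k)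
      (∣m∣n⇒∣m+n (p∣[p+d]Ck pp d<k (<-trans (n<1+n k) k<p))
                 (p∣[p+d]Ck pp (<-trans d<k (n<1+n k)) k<p))

-- The number of r-element subsets of an (f + s)-set that contain a fixed s-subset, i.e. f C (r ∸ s) for s ≤ r.
shiftedC : ℕ → ℕ → ℕ → ℕ
shiftedC f zero r = f C r
shiftedC f (suc s) zero = 0
shiftedC f (suc s) (suc r) = shiftedC f s r

shiftedC-zero : ∀ f s → shiftedC (suc f) s 0 ≡ shiftedC f s 0
shiftedC-zero f zero = refl
shiftedC-zero f (suc s) = refl

shiftedC-pascal : ∀ f s r → shiftedC f s r + shiftedC f s (suc r) ≡ shiftedC (suc f) s (suc r)
shiftedC-pascal f zero r = nCk+nC[k+1]≡[n+1]C[k+1] f r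
shiftedC-pascal f (suc s) zero = sym (shiftedC-zero f s)
shiftedC-pascal f (suc s) (suc r) = shiftedC-pascal f s r

shiftedC-≤ : ∀ f {s r} → s ≤ r → shiftedC f s r ≡ f C (r ∸ s)
shiftedC-≤ f {zero} _ = refl
shiftedC-≤ f {suc s} (s≤s s≤r) = shiftedC-≤ f s≤r

shiftedC-> : ∀ f {s r} → r < s → shiftedC f s r ≡ 0
shiftedC-> f {suc s} {zero} _ = refl
shiftedC-> f {suc s} {suc r} (s≤s r<s) = shiftedC-> f r<s

p∣shiftedC : ∀ {q} → Prime (suc q) → ∀ {f s} → suc q ≤ f → f + s ≤ q + q → suc q ∣ shiftedC f s q
p∣shiftedC {q} pp {f} {s} p≤f f+s≤2q with s ≤? q
... | no s≰q = subst (suc q ∣_) (sym (shiftedC-> f (≰⇒> s≰q))) (suc q ∣0)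
... | yes s≤q = subst (suc q ∣_) (sym (shiftedC-≤ f s≤q))
      (subst (λ f → suc q ∣ f C (q ∸ s)) (m+[n∸m]≡n p≤f) (p∣[p+d]Ck pp d<q∸s (s≤s (m∸n≤m q s))))
  where
  d = f ∸ suc q
  d<q∸s : d < q ∸ s
  d<q∸s = m+n≤o⇒m≤o∸n (suc d) (+-cancelˡ-≤ q (suc (d + s)) q (begin
    q + suc (d + s)   ≡⟨ +-suc q (d + s) ⟩
    suc q + (d + s)   ≡⟨ +-assoc (suc q) d s ⟨
    (suc q + d) + s   ≡⟨ cong (_+ s) (m+[n∸m]≡n p≤f) ⟩
    f + s             ≤⟨ f+s≤2q ⟩
    q + q             ∎))
    where open ≤-Reasoning

-- Counting words with restricted letters

count : {A : Set} → (A → Bool) → List A → ℕ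
count g [] = 0
count g (x ∷ xs) = if g x then suc (count g xs) else count g xs

count-++ : {A : Set} (g : A → Bool) (xs ys : List A) → count g (xs List.++ ys) ≡ count g xs + count g ys
count-++ g [] ys = refl
count-++ g (x ∷ xs) ys with g x
... | true = cong suc (count-++ g xs ys)
... | false = count-++ g xs ys

count-map : {A B : Set} (g : B → Bool) (f : A → B) (xs : List A) → count g (List.map f xs) ≡ count (λ x → g (f x)) xs
count-map g f [] = refl
count-map g f (x ∷ xs) with g (f x)
... | true = cong suc (count-map g f xs)
... | false = count-map g f xs

count-cong : {A : Set} {g h : A → Bool} → (∀ x → g x ≡ h x) → (xs : List A) → count g xs ≡ count h xs
count-cong g≗h [] = refl
count-cong {h = h} g≗h (x ∷ xs) rewrite g≗h x with h x
... | true = cong suc (count-cong g≗h xs)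
... | false = count-cong g≗h xs

count-false : {A : Set} (xs : List A) → count (λ _ → false) xs ≡ 0
count-false [] = refl
count-false (x ∷ xs) = count-false xs

count-guard : {A : Set} (a : Bool) (g : A → Bool) (xs : List A) → count (λ x → a ∧ g x) xs ≡ (if a then count g xs else 0)
count-guard true g xs = refl
count-guard false g xs = count-false xs

length-filter-T? : {A : Set} (g : A → Bool) (xs : List A) → List.length (List.filter (λ x → T? (g x)) xs) ≡ count g xs
length-filter-T? g [] = refl
length-filter-T? g (x ∷ xs) with g x
... | true = cong suc (length-filter-T? g xs)
... | false = length-filter-T? g xs

allVecs : {A : Set} → List A → ∀ k → List (Vec A k)
allVecs xs zero = [] ∷ []
allVecs xs (suc k) = cartesianProductWith _∷_ xs (allVecs xs k)

∈-allVecs : {A : Set} {xs : List A} → (∀ x → x ∈ xs) → ∀ {k} (v : Vec A k) → v ∈ allVecs xs k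
∈-allVecs ∈xs [] = here refl
∈-allVecs ∈xs (x ∷ v) = ∈-cartesianProductWith⁺ _∷_ (∈xs x) (∈-allVecs ∈xs v)

allVecs-unique : {A : Set} {xs : List A} → Unique xs → ∀ k → Unique (allVecs xs k)
allVecs-unique u zero = [] ∷ []
allVecs-unique u (suc k) = Uniqueₚ.cartesianProductWith⁺ _∷_ Vecₚ.∷-injective u (allVecs-unique u k)

allWords : ∀ K → List (Vec Bool K)
allWords = allVecs (true ∷ false ∷ [])

∈-allWords : ∀ {K} (w : Vec Bool K) → w ∈ allWords K
∈-allWords = ∈-allVecs λ { true → here refl ; false → there (here refl) }

allWords-unique : ∀ K → Unique (allWords K)
allWords-unique = allVecs-unique (((λ ()) ∷ []) ∷ [] ∷ [])

count-allWords : ∀ {K} (g : Vec Bool (suc K) → Bool) →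
  count g (allWords (suc K)) ≡ count (λ w → g (true ∷ w)) (allWords K) + count (λ w → g (false ∷ w)) (allWords K)
count-allWords {K} g = begin
  count g (List.map (true ∷_) ws List.++ (List.map (false ∷_) ws List.++ []))
    ≡⟨ count-++ g (List.map (true ∷_) ws) _ ⟩
  count g (List.map (true ∷_) ws) + count g (List.map (false ∷_) ws List.++ [])
    ≡⟨ cong₂ _+_ (count-map g (true ∷_) ws) (cong (count g) (Listₚ.++-identityʳ (List.map (false ∷_) ws))) ⟩
  count (λ w → g (true ∷ w)) ws + count g (List.map (false ∷_) ws)
    ≡⟨ cong (count (λ w → g (true ∷ w)) ws +_) (count-map g (false ∷_) ws) ⟩
  count (λ w → g (true ∷ w)) ws + count (λ w → g (false ∷ w)) ws ∎
  where
  open ≡-Reasoning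
  ws = allWords K

allows : Bool × Bool → Bool → Bool
allows (a , b) true = a
allows (a , b) false = b

restriction : {Q : Bool → Set} → (∀ x → Dec (Q x)) → Bool × Bool
restriction Q? = isYes (Q? true) , isYes (Q? false)

T-allows-restriction : {Q : Bool → Set} (Q? : ∀ x → Dec (Q x)) (x : Bool) → T (allows (restriction Q?) x) ⇔ Q x
T-allows-restriction Q? true = mk⇔ toWitness fromWitness
T-allows-restriction Q? false = mk⇔ toWitness fromWitness

Symmetric : Bool × Bool → Set
Symmetric (a , b) = a ≡ b

restriction-symmetric : {Q : Bool → Set} (Q? : ∀ x → Dec (Q x)) → Q true ⇔ Q false → Symmetric (restriction Q?)
restriction-symmetric Q? Qt⇔Qf =
  trans (isYes≗does (Q? true)) (trans (does-⇔ Qt⇔Qf (Q? true) (Q? false)) (sym (isYes≗does (Q? false))))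

Unblocked : Bool × Bool → Set
Unblocked o = o ≢ (false , false)

unblocked? : (o : Bool × Bool) → Dec (Unblocked o)
unblocked? (true , _) = yes (λ ())
unblocked? (false , true) = yes (λ ())
unblocked? (false , false) = no (λ ff≢ff → ff≢ff refl)

admissible : ∀ {K} → Vec (Bool × Bool) K → Vec Bool K → Bool
admissible [] [] = true
admissible (o ∷ ok) (x ∷ w) = allows o x ∧ admissible ok w

trues : ∀ {K} → Vec Bool K → ℕ
trues [] = 0
trues (true ∷ w) = suc (trues w)
trues (false ∷ w) = trues w

admits : ∀ {K} → Vec (Bool × Bool) K → ℕ → Vec Bool K → Bool
admits ok r w = admissible ok w ∧ (trues w ≡ᵇ r)

#free : ∀ {K} → Vec (Bool × Bool) K → ℕ
#free [] = 0
#free ((true , true) ∷ ok) = suc (#free ok)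
#free (_ ∷ ok) = #free ok

#forcedTrue : ∀ {K} → Vec (Bool × Bool) K → ℕ
#forcedTrue [] = 0
#forcedTrue ((true , false) ∷ ok) = suc (#forcedTrue ok)
#forcedTrue (_ ∷ ok) = #forcedTrue ok

#symmetric : ∀ {K} → Vec (Bool × Bool) K → ℕ
#symmetric [] = 0
#symmetric ((true , true) ∷ ok) = suc (#symmetric ok)
#symmetric ((false , false) ∷ ok) = suc (#symmetric ok)
#symmetric (_ ∷ ok) = #symmetric ok

count-guarded-admits : ∀ {K} (a : Bool) (ok : Vec (Bool × Bool) K) r {g : Vec Bool K → Bool} →
  (∀ w → g w ≡ (a ∧ admissible ok w) ∧ (trues w ≡ᵇ r)) →
  count g (allWords K) ≡ (if a then count (admits ok r) (allWords K) else 0)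
count-guarded-admits {K} a ok r g≗ = trans (count-cong (λ w → trans (g≗ w) (Boolₚ.∧-assoc a _ _)) (allWords K))
                                           (count-guard a (admits ok r) (allWords K))

count-admits-∷-zero : ∀ {K} a b (ok : Vec (Bool × Bool) K) →
  count (admits ((a , b) ∷ ok) 0) (allWords (suc K)) ≡ (if b then count (admits ok 0) (allWords K) else 0)
count-admits-∷-zero {K} a b ok = begin
  count (admits ((a , b) ∷ ok) 0) (allWords (suc K))
    ≡⟨ count-allWords (admits ((a , b) ∷ ok) 0) ⟩
  count (λ w → (a ∧ admissible ok w) ∧ false) (allWords K) + count (λ w → (b ∧ admissible ok w) ∧ (trues w ≡ᵇ 0)) (allWords K)
    ≡⟨ cong₂ _+_ (trans (count-cong (λ w → Boolₚ.∧-zeroʳ _) (allWords K)) (count-false (allWords K)))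
                 (count-guarded-admits b ok 0 (λ w → refl)) ⟩
  (if b then count (admits ok 0) (allWords K) else 0) ∎
  where open ≡-Reasoning

count-admits-∷-suc : ∀ {K} a b (ok : Vec (Bool × Bool) K) r →
  count (admits ((a , b) ∷ ok) (suc r)) (allWords (suc K)) ≡
    (if a then count (admits ok r) (allWords K) else 0) + (if b then count (admits ok (suc r)) (allWords K) else 0)
count-admits-∷-suc {K} a b ok r =
  trans (count-allWords (admits ((a , b) ∷ ok) (suc r)))
        (cong₂ _+_ (count-guarded-admits a ok r (λ w → refl)) (count-guarded-admits b ok (suc r) (λ w → refl)))

count-admits : ∀ {K} {ok : Vec (Bool × Bool) K} → All Unblocked ok → ∀ r →
  count (admits ok r) (allWords K) ≡ shiftedC (#free ok) (#forcedTrue ok) r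
count-admits [] zero = refl
count-admits [] (suc r) = refl
count-admits {ok = (true , true) ∷ ok} (_ ∷ u) zero =
  trans (count-admits-∷-zero true true ok) (trans (count-admits u 0) (sym (shiftedC-zero (#free ok) (#forcedTrue ok))))
count-admits {ok = (true , true) ∷ ok} (_ ∷ u) (suc r) =
  trans (count-admits-∷-suc true true ok r)
        (trans (cong₂ _+_ (count-admits u r) (count-admits u (suc r))) (shiftedC-pascal (#free ok) (#forcedTrue ok) r))
count-admits {ok = (true , false) ∷ ok} (_ ∷ u) zero = count-admits-∷-zero true false ok
count-admits {ok = (true , false) ∷ ok} (_ ∷ u) (suc r) =
  trans (count-admits-∷-suc true false ok r) (trans (+-identityʳ _) (count-admits u r))
count-admits {ok = (false , true) ∷ ok} (_ ∷ u) zero = trans (count-admits-∷-zero false true ok) (count-admits u 0)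
count-admits {ok = (false , true) ∷ ok} (_ ∷ u) (suc r) = trans (count-admits-∷-suc false true ok r) (count-admits u (suc r))
count-admits {ok = (false , false) ∷ ok} (ff≢ff ∷ _) r = ⊥-elim (ff≢ff refl)

allows⇒unblocked : ∀ o x → allows o x ≡ true → Unblocked o
allows⇒unblocked (false , false) true () _
allows⇒unblocked (false , false) false () _
allows⇒unblocked (true , _) _ _ ()
allows⇒unblocked (false , true) _ _ ()

admissible-blocked : ∀ {K} (ok : Vec (Bool × Bool) K) → ¬ All Unblocked ok → ∀ w → admissible ok w ≡ false
admissible-blocked [] blocked [] = ⊥-elim (blocked [])
admissible-blocked (o ∷ ok) blocked (x ∷ w) with allows o x in allowed
... | false = refl
... | true = admissible-blocked ok (λ u → blocked (allows⇒unblocked o x allowed ∷ u)) w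

#free≡#symmetric : ∀ {K} {ok : Vec (Bool × Bool) K} → All Unblocked ok → #free ok ≡ #symmetric ok
#free≡#symmetric [] = refl
#free≡#symmetric {ok = (true , true) ∷ _} (_ ∷ u) = cong suc (#free≡#symmetric u)
#free≡#symmetric {ok = (true , false) ∷ _} (_ ∷ u) = #free≡#symmetric u
#free≡#symmetric {ok = (false , true) ∷ _} (_ ∷ u) = #free≡#symmetric u
#free≡#symmetric {ok = (false , false) ∷ _} (ff≢ff ∷ _) = ⊥-elim (ff≢ff refl)

#free+#forcedTrue≤length : ∀ {K} (ok : Vec (Bool × Bool) K) → #free ok + #forcedTrue ok ≤ K
#free+#forcedTrue≤length [] = z≤n
#free+#forcedTrue≤length ((true , true) ∷ ok) = s≤s (#free+#forcedTrue≤length ok)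
#free+#forcedTrue≤length ((true , false) ∷ ok) rewrite +-suc (#free ok) (#forcedTrue ok) = s≤s (#free+#forcedTrue≤length ok)
#free+#forcedTrue≤length ((false , true) ∷ ok) = m≤n⇒m≤1+n (#free+#forcedTrue≤length ok)
#free+#forcedTrue≤length ((false , false) ∷ ok) = m≤n⇒m≤1+n (#free+#forcedTrue≤length ok)

-- If no position is blocked, the count is C(f, q - s) with f ≥ p free and s forced-true positions, f + s ≤ 2q.
p∣count-admits : ∀ {q} → Prime (suc q) → (ok : Vec (Bool × Bool) (q + q)) → suc q ≤ #symmetric ok →
  suc q ∣ count (admits ok q) (allWords (q + q))
p∣count-admits {q} pp ok p≤#sym with all? unblocked? ok
... | yes u = subst (suc q ∣_) (sym (count-admits u q))
        (p∣shiftedC pp (subst (suc q ≤_) (sym (#free≡#symmetric u)) p≤#sym) (#free+#forcedTrue≤length ok))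
... | no blocked = subst (suc q ∣_) (sym count≡0) (suc q ∣0)
  where
  count≡0 : count (admits ok q) (allWords (q + q)) ≡ 0
  count≡0 = trans (count-cong (λ w → cong (_∧ _) (admissible-blocked ok blocked w)) (allWords (q + q)))
                  (count-false (allWords (q + q)))

Allowed : ∀ {K} → Vec (Bool × Bool) K → Vec Bool K → Set
Allowed ok w = ∀ j → T (allows (lookup ok j) (lookup w j))

T-admissible : ∀ {K} (ok : Vec (Bool × Bool) K) w → T (admissible ok w) ⇔ Allowed ok w
T-admissible [] [] = mk⇔ (λ _ ()) _
T-admissible (o ∷ ok) (x ∷ w) = mk⇔
  (λ t → λ { Fin.zero → proj₁ (Equivalence.to Boolₚ.T-∧ t) ; (Fin.suc j) → Equivalence.to (T-admissible ok w) (proj₂ (Equivalence.to Boolₚ.T-∧ t)) j })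
  (λ allowed → Equivalence.from Boolₚ.T-∧ (allowed Fin.zero , Equivalence.from (T-admissible ok w) (allowed ∘ Fin.suc)))

admissible-++ : ∀ {K L} (xs : Vec (Bool × Bool) K) (ys : Vec (Bool × Bool) L) ws vs →
  admissible (xs ++ ys) (ws ++ vs) ≡ admissible xs ws ∧ admissible ys vs
admissible-++ [] ys [] vs = refl
admissible-++ (o ∷ xs) ys (x ∷ ws) vs =
  trans (cong (allows o x ∧_) (admissible-++ xs ys ws vs)) (sym (Boolₚ.∧-assoc (allows o x) _ _))

trues-++ : ∀ {K L} (ws : Vec Bool K) (vs : Vec Bool L) → trues (ws ++ vs) ≡ trues ws + trues vs
trues-++ [] vs = refl
trues-++ (true ∷ ws) vs = cong suc (trues-++ ws vs)
trues-++ (false ∷ ws) vs = trues-++ ws vs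

falses : ∀ {K} → Vec Bool K → ℕ
falses [] = 0
falses (true ∷ w) = falses w
falses (false ∷ w) = suc (falses w)

trues+falses≡length : ∀ {K} (w : Vec Bool K) → trues w + falses w ≡ K
trues+falses≡length [] = refl
trues+falses≡length (true ∷ w) = cong suc (trues+falses≡length w)
trues+falses≡length (false ∷ w) = trans (+-suc (trues w) (falses w)) (cong suc (trues+falses≡length w))

T-admits-++ : ∀ {K L} (xs : Vec (Bool × Bool) K) (ys : Vec (Bool × Bool) L) r ws vs →
  T (admits (xs ++ ys) r (ws ++ vs)) ⇔ (Allowed xs ws × Allowed ys vs × trues ws + trues vs ≡ r)
T-admits-++ xs ys r ws vs
  rewrite admissible-++ xs ys ws vs | trues-++ ws vs = mk⇔
  (λ t → let (xs∧ys , ≡r) = Equivalence.to Boolₚ.T-∧ t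
             (tx , ty) = Equivalence.to Boolₚ.T-∧ xs∧ys
         in Equivalence.to (T-admissible xs ws) tx , Equivalence.to (T-admissible ys vs) ty , ≡ᵇ⇒≡ _ r ≡r)
  (λ (ax , ay , ≡r) → Equivalence.from Boolₚ.T-∧
     (Equivalence.from Boolₚ.T-∧ (Equivalence.from (T-admissible xs ws) ax , Equivalence.from (T-admissible ys vs) ay) ,
      ≡⇒≡ᵇ _ r ≡r))

Allowed-restrictions : ∀ {K} {Q : Fin K → Bool → Set} (Q? : ∀ j x → Dec (Q j x)) (w : Vec Bool K) →
  Allowed (Vec.tabulate λ j → restriction (Q? j)) w ⇔ (∀ j → Q j (lookup w j))
Allowed-restrictions Q? w = mk⇔
  (λ allowed j → Equivalence.to (T-allows-restriction (Q? j) (lookup w j))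
                   (subst (λ o → T (allows o (lookup w j))) (Vecₚ.lookup∘tabulate _ j) (allowed j)))
  (λ Qw j → subst (λ o → T (allows o (lookup w j))) (sym (Vecₚ.lookup∘tabulate _ j))
              (Equivalence.from (T-allows-restriction (Q? j) (lookup w j)) (Qw j)))

#symmetric-++ : ∀ {K L} (xs : Vec (Bool × Bool) K) (ys : Vec (Bool × Bool) L) → #symmetric (xs ++ ys) ≡ #symmetric xs + #symmetric ys
#symmetric-++ [] ys = refl
#symmetric-++ ((true , true) ∷ xs) ys = cong suc (#symmetric-++ xs ys)
#symmetric-++ ((true , false) ∷ xs) ys = #symmetric-++ xs ys
#symmetric-++ ((false , true) ∷ xs) ys = #symmetric-++ xs ys
#symmetric-++ ((false , false) ∷ xs) ys = cong suc (#symmetric-++ xs ys)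

#symmetric-all : ∀ {K} (ok : Vec (Bool × Bool) K) → (∀ j → Symmetric (lookup ok j)) → #symmetric ok ≡ K
#symmetric-all [] _ = refl
#symmetric-all ((true , true) ∷ ok) symmetric = cong suc (#symmetric-all ok (symmetric ∘ Fin.suc))
#symmetric-all ((false , false) ∷ ok) symmetric = cong suc (#symmetric-all ok (symmetric ∘ Fin.suc))
#symmetric-all ((true , false) ∷ ok) symmetric with symmetric Fin.zero
... | ()
#symmetric-all ((false , true) ∷ ok) symmetric with symmetric Fin.zero
... | ()

#symmetric-lookup : ∀ {K} (ok : Vec (Bool × Bool) K) j → Symmetric (lookup ok j) → 1 ≤ #symmetric ok
#symmetric-lookup ((true , true) ∷ ok) _ _ = s≤s z≤n
#symmetric-lookup ((false , false) ∷ ok) _ _ = s≤s z≤n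
#symmetric-lookup ((true , false) ∷ ok) (Fin.suc j) symmetric = #symmetric-lookup ok j symmetric
#symmetric-lookup ((false , true) ∷ ok) (Fin.suc j) symmetric = #symmetric-lookup ok j symmetric

-- Partitions into blocks of size divisible by p

length-concat : {A : Set} (bs : List (List A)) → List.length (List.concat bs) ≡ ListSum.sum (List.map List.length bs)
length-concat [] = refl
length-concat (b ∷ bs) = trans (Listₚ.length-++ b) (cong (List.length b +_) (length-concat bs))

∣sum : ∀ {p} (ns : List ℕ) → ListAll.All (p ∣_) ns → p ∣ ListSum.sum ns
∣sum [] [] = _ ∣0
∣sum (n ∷ ns) (p∣n ∷ p∣ns) = ∣m∣n⇒∣m+n p∣n (∣sum ns p∣ns)

length-filter-split : {A : Set} {Q₁ Q₂ : A → Set} (Q₁? : Decidable Q₁) (Q₂? : Decidable Q₂) →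
  (∀ t → Q₁ t → Q₂ t → ⊥) → ∀ xs → ListAll.All (λ t → Q₁ t ⊎ Q₂ t) xs →
  List.length (List.filter Q₁? xs) + List.length (List.filter Q₂? xs) ≡ List.length xs
length-filter-split Q₁? Q₂? disjoint [] [] = refl
length-filter-split Q₁? Q₂? disjoint (x ∷ xs) (q ∷ qs) with Q₁? x | Q₂? x
... | yes q₁ | yes q₂ = ⊥-elim (disjoint x q₁ q₂)
... | yes _ | no _ = cong suc (length-filter-split Q₁? Q₂? disjoint xs qs)
... | no _ | yes _ = trans (+-suc _ _) (cong suc (length-filter-split Q₁? Q₂? disjoint xs qs))
... | no ¬q₁ | no ¬q₂ = ⊥-elim (Sum.[ ¬q₁ , ¬q₂ ] q)

HasSize-filter : {A : Set} {Q Q' : A → Set} (Q? : Decidable Q) (xs : List A) → Unique xs →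
  (∀ t → (t ∈ xs → Q' t) × (Q' t → t ∈ xs)) → (∀ t → Q t → Q' t) → HasSize Q (List.length (List.filter Q? xs))
HasSize-filter Q? xs u xs≈Q' Q⊆Q' = List.filter Q? xs , Uniqueₚ.filter⁺ Q? u , refl , λ t →
  (λ t∈ → proj₂ (∈-filter⁻ Q? {xs = xs} t∈)) , (λ q → ∈-filter⁺ Q? (proj₂ (xs≈Q' t) (Q⊆Q' t q)) q)

-- k₁ + k₂ is the size of the union, which is the total size of the blocks.
PartitionDivBy⇒∣sizes : ∀ {A : Set} {p} {Q₁ Q₂ : A → Set} → PartitionDivBy p (λ t → Q₁ t ⊎ Q₂ t) →
  Decidable Q₁ → Decidable Q₂ → (∀ t → Q₁ t → Q₂ t → ⊥) →
  ∃[ k₁ ] ∃[ k₂ ] (HasSize Q₁ k₁ × HasSize Q₂ k₂ × p ∣ k₁ + k₂)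
PartitionDivBy⇒∣sizes {p = p} (blocks , unique , elements , divisible) Q₁? Q₂? disjoint =
  _ , _ , HasSize-filter Q₁? xs unique elements (λ _ → inj₁) , HasSize-filter Q₂? xs unique elements (λ _ → inj₂) ,
  subst (p ∣_) (sym (length-filter-split Q₁? Q₂? disjoint xs (ListAll.tabulate (λ {t} → proj₁ (elements t)))))
    (subst (p ∣_) (sym (length-concat blocks))
      (∣sum (List.map List.length blocks) (ListAllₚ.map⁺ (ListAll.map proj₂ divisible))))
  where xs = List.concat blocks

PartitionDivBy-empty : ∀ {A : Set} {p} {Q : A → Set} → (∀ t → ¬ Q t) → PartitionDivBy p Q
PartitionDivBy-empty ¬Q = [] , [] , (λ t → (λ ()) , λ q → ⊥-elim (¬Q t q)) , []

AllPairs-from-∈ : {A : Set} {R : A → A → Set} {xs : List A} →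
  (∀ {x y} → x ∈ xs → y ∈ xs → x ≢ y → R x y) → Unique xs → AllPairs.AllPairs R xs
AllPairs-from-∈ R-∈ [] = []
AllPairs-from-∈ R-∈ (x∉xs ∷ u) =
  ListAll.tabulate (λ y∈ → R-∈ (here refl) (there y∈) (ListAll.lookup x∉xs y∈)) ∷ AllPairs-from-∈ (λ x∈ y∈ → R-∈ (there x∈) (there y∈)) u

-- The block of a base β consists of the apply β w for the words w good for β.
module BlockPartition {B W C : Set} (p : ℕ) (U : C → Set) (bases : List B) (words : List W)
  (bases-unique : Unique bases) (words-unique : Unique words)
  (apply : B → W → C) {Good : B → W → Set} (good? : ∀ β → Decidable (Good β))
  (apply-injectiveʳ : ∀ β {w w'} → apply β w ≡ apply β w' → w ≡ w')
  (apply-injectiveˡ : ∀ {β β' w w'} → β ∈ bases → β' ∈ bases → apply β w ≡ apply β' w' → β ≡ β')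
  (apply-sound : ∀ {β w} → β ∈ bases → Good β w → U (apply β w))
  (apply-complete : ∀ t → U t → ∃[ β ] ∃[ w ] (β ∈ bases × w ∈ words × Good β w × t ≡ apply β w))
  (p∣#good : ∀ {β} → β ∈ bases → p ∣ List.length (List.filter (good? β) words)) where

  private
    block : B → List C
    block β = List.map (apply β) (List.filter (good? β) words)

    nonempty? : Decidable (λ (b : List C) → b ≢ [])
    nonempty? [] = no (λ []≢[] → []≢[] refl)
    nonempty? (_ ∷ _) = yes (λ ())

    blocks : List (List C)
    blocks = List.filter nonempty? (List.map block bases)

    ∈-block⁻ : ∀ {β t} → t ∈ block β → ∃[ w ] (w ∈ words × Good β w × t ≡ apply β w)
    ∈-block⁻ {β} t∈ with ∈-map⁻ (apply β) t∈
    ... | w , w∈ , refl with ∈-filter⁻ (good? β) w∈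
    ...   | w∈words , good = w , w∈words , good , refl

    unique : Unique (List.concat blocks)
    unique = Uniqueₚ.concat⁺
      (ListAllₚ.filter⁺ nonempty? (ListAllₚ.map⁺ (ListAll.tabulate {xs = bases} λ {β} _ →
        Uniqueₚ.map⁺ (apply-injectiveʳ β) (Uniqueₚ.filter⁺ (good? β) words-unique))))
      (AllPairsₚ.filter⁺ nonempty? (AllPairsₚ.map⁺ (AllPairs-from-∈ disjoint bases-unique)))
      where
      disjoint : ∀ {β β'} → β ∈ bases → β' ∈ bases → β ≢ β' → Disjoint (block β) (block β')
      disjoint β∈ β'∈ β≢β' (t∈ , t∈') with ∈-block⁻ t∈ | ∈-block⁻ t∈'
      ... | _ , _ , _ , refl | _ , _ , _ , eq = β≢β' (apply-injectiveˡ β∈ β'∈ eq)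

    elements : ∀ t → (t ∈ List.concat blocks → U t) × (U t → t ∈ List.concat blocks)
    elements t = sound , complete
      where
      sound : t ∈ List.concat blocks → U t
      sound t∈ with ∈-concat⁻′ blocks t∈
      ... | b , t∈b , b∈ with ∈-map⁻ block (proj₁ (∈-filter⁻ nonempty? b∈))
      ...   | β , β∈ , refl with ∈-block⁻ t∈b
      ...     | w , _ , good , refl = apply-sound β∈ good
      complete : U t → t ∈ List.concat blocks
      complete u with apply-complete t u
      ... | β , w , β∈ , w∈ , good , refl =
        ∈-concat⁺′ t∈ (∈-filter⁺ nonempty? (∈-map⁺ block β∈) λ b≡[] → case (subst (apply β w ∈_) b≡[] t∈) of λ ())
        where
        t∈ : apply β w ∈ block β
        t∈ = ∈-map⁺ (apply β) (∈-filter⁺ (good? β) w∈ good)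

    divisible : ListAll.All (λ b → b ≢ [] × p ∣ List.length b) blocks
    divisible = ListAll.zip (ListAllₚ.all-filter nonempty? (List.map block bases) ,
      ListAllₚ.filter⁺ nonempty? (ListAllₚ.map⁺ (ListAll.tabulate {xs = bases} λ {β} β∈ →
        subst (p ∣_) (sym (Listₚ.length-map (apply β) (List.filter (good? β) words))) (p∣#good β∈))))

  partition : PartitionDivBy p U
  partition = blocks , unique , elements , divisible

-- Sums of natural numbers

sum≡0⇒≡0 : ∀ {k} (f : Fin k → ℕ) → Vec.sum (Vec.tabulate f) ≡ 0 → ∀ i → f i ≡ 0
sum≡0⇒≡0 {suc k} f Σ≡0 Fin.zero with f Fin.zero | Σ≡0
... | zero | _ = refl
sum≡0⇒≡0 {suc k} f Σ≡0 (Fin.suc i) with f Fin.zero | Σ≡0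
... | zero | Σ'≡0 = sum≡0⇒≡0 (f ∘ Fin.suc) Σ'≡0 i

sum≡1⇒single : ∀ {k} (f : Fin k → ℕ) → Vec.sum (Vec.tabulate f) ≡ 1 → ∃[ i ] (f i ≡ 1 × ∀ j → j ≢ i → f j ≡ 0)
sum≡1⇒single {suc k} f Σ≡1 with f Fin.zero in f0
... | zero with sum≡1⇒single (f ∘ Fin.suc) Σ≡1
...   | i , fi≡1 , rest = Fin.suc i , fi≡1 , λ { Fin.zero _ → f0 ; (Fin.suc j) j≢i → rest j (j≢i ∘ cong Fin.suc) }
sum≡1⇒single {suc k} f Σ≡1 | suc zero =
  Fin.zero , f0 , λ { Fin.zero 0≢0 → ⊥-elim (0≢0 refl) ; (Fin.suc j) _ → sum≡0⇒≡0 (f ∘ Fin.suc) (suc-injective Σ≡1) j }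

ExactlyTwoOnes : ∀ {k} → (Fin k → ℕ) → Set
ExactlyTwoOnes f = ∃[ i ] ∃[ j ] (i ≢ j × f i ≡ 1 × f j ≡ 1 × ∀ l → l ≢ i → l ≢ j → f l ≡ 0)

sum≡2⇒ : ∀ {k} (f : Fin k → ℕ) → Vec.sum (Vec.tabulate f) ≡ 2 → (∃[ i ] 2 ≤ f i) ⊎ ExactlyTwoOnes f
sum≡2⇒ {suc k} f Σ≡2 with f Fin.zero in f0
... | zero with sum≡2⇒ (f ∘ Fin.suc) Σ≡2
...   | inj₁ (i , 2≤fi) = inj₁ (Fin.suc i , 2≤fi)
...   | inj₂ (i , j , i≢j , fi≡1 , fj≡1 , rest) =
  inj₂ (Fin.suc i , Fin.suc j , i≢j ∘ Finₚ.suc-injective , fi≡1 , fj≡1 ,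
        λ { Fin.zero _ _ → f0 ; (Fin.suc l) l≢i l≢j → rest l (l≢i ∘ cong Fin.suc) (l≢j ∘ cong Fin.suc) })
sum≡2⇒ {suc k} f Σ≡2 | suc zero with sum≡1⇒single (f ∘ Fin.suc) (suc-injective Σ≡2)
... | j , fj≡1 , rest = inj₂ (Fin.zero , Fin.suc j , (λ ()) , f0 , fj≡1 ,
        λ { Fin.zero 0≢0 _ → ⊥-elim (0≢0 refl) ; (Fin.suc l) _ l≢j → rest l (l≢j ∘ cong Fin.suc) })
sum≡2⇒ {suc k} f Σ≡2 | suc (suc _) = inj₁ (Fin.zero , subst (2 ≤_) (sym f0) (s≤s (s≤s z≤n)))

length≤sum : ∀ {K} (ns : Vec ℕ K) → (∀ j → 1 ≤ lookup ns j) → K ≤ Vec.sum ns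
length≤sum [] _ = z≤n
length≤sum (n ∷ ns) 1≤ns = +-mono-≤ (1≤ns Fin.zero) (length≤sum ns (1≤ns ∘ Fin.suc))

private
  sum≡length⇒head≡1 : ∀ {K} n (ns : Vec ℕ K) → (∀ j → 1 ≤ lookup (n ∷ ns) j) → n + Vec.sum ns ≡ suc K → n ≡ 1
  sum≡length⇒head≡1 {K} n ns 1≤ns Σ≡K = ≤-antisym (+-cancelʳ-≤ K n 1 (begin
    n + K          ≤⟨ +-monoʳ-≤ n (length≤sum ns (1≤ns ∘ Fin.suc)) ⟩
    n + Vec.sum ns ≡⟨ Σ≡K ⟩
    suc K          ∎)) (1≤ns Fin.zero)
    where open ≤-Reasoning

sum≡length⇒≡1 : ∀ {K} (ns : Vec ℕ K) → (∀ j → 1 ≤ lookup ns j) → Vec.sum ns ≡ K → ∀ j → lookup ns j ≡ 1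
sum≡length⇒≡1 (n ∷ ns) 1≤ns Σ≡K Fin.zero = sum≡length⇒head≡1 n ns 1≤ns Σ≡K
sum≡length⇒≡1 (n ∷ ns) 1≤ns Σ≡K (Fin.suc j) = sum≡length⇒≡1 ns (1≤ns ∘ Fin.suc)
  (suc-injective (trans (cong (_+ Vec.sum ns) (sym (sum≡length⇒head≡1 n ns 1≤ns Σ≡K))) Σ≡K)) j

module Connectivity (G : Graph) where

  Joins-sym : ∀ {e u w} → Joins G e u w → Joins G e w u
  Joins-sym (inj₁ e≡uw) = inj₂ e≡uw
  Joins-sym (inj₂ e≡wu) = inj₁ e≡wu

  data WalkIn (P : Fin (m G) → Set) : Fin (n G) → Fin (n G) → Set where
    here : ∀ {v} → WalkIn P v v
    step : ∀ {u w v} (e : Fin (m G)) → P e → Joins G e u w → WalkIn P w v → WalkIn P u v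

  module _ {P : Fin (m G) → Set} where

    WalkIn-trans : ∀ {u v w} → WalkIn P u v → WalkIn P v w → WalkIn P u w
    WalkIn-trans here q = q
    WalkIn-trans (step e pe j p) q = step e pe j (WalkIn-trans p q)

    WalkIn-sym : ∀ {u v} → WalkIn P u v → WalkIn P v u
    WalkIn-sym here = here
    WalkIn-sym (step e pe j p) = WalkIn-trans (WalkIn-sym p) (step e pe (Joins-sym j) here)

  WalkIn-mono : ∀ {P Q : Fin (m G) → Set} → (∀ e → P e → Q e) → ∀ {u v} → WalkIn P u v → WalkIn Q u v
  WalkIn-mono P⊆Q here = here
  WalkIn-mono P⊆Q (step e pe j p) = step e (P⊆Q e pe) j (WalkIn-mono P⊆Q p)

  walk⇒walkIn : ∀ {S u v es} → Walk G S u v es → WalkIn (λ e → InE G e S) u v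
  walk⇒walkIn here = here
  walk⇒walkIn (step e e∈S j w) = step e e∈S j (walk⇒walkIn w)

  walkIn⇒Conn : ∀ {S u v} → WalkIn (λ e → InE G e S) u v → Conn G S u v
  walkIn⇒Conn here = [] , here
  walkIn⇒Conn (step e e∈S j p) with walkIn⇒Conn p
  ... | es , w = e ∷ es , step e e∈S j w

  Conn-refl : ∀ {S u} → Conn G S u u
  Conn-refl = [] , here

  Conn-trans : ∀ {S u v w} → Conn G S u v → Conn G S v w → Conn G S u w
  Conn-trans (_ , p) (_ , q) = walkIn⇒Conn (WalkIn-trans (walk⇒walkIn p) (walk⇒walkIn q))

  Conn-sym : ∀ {S u v} → Conn G S u v → Conn G S v u
  Conn-sym (_ , p) = walkIn⇒Conn (WalkIn-sym (walk⇒walkIn p))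

  Conn-mono : ∀ {S S'} → (∀ e → InE G e S → InE G e S') → ∀ {u v} → Conn G S u v → Conn G S' u v
  Conn-mono S⊆S' (_ , p) = walkIn⇒Conn (WalkIn-mono S⊆S' (walk⇒walkIn p))

  Walk-mono : ∀ {S S'} → (∀ e → InE G e S → InE G e S') → ∀ {u v es} → Walk G S u v es → Walk G S' u v es
  Walk-mono S⊆S' here = here
  Walk-mono S⊆S' (step e e∈S j w) = step e (S⊆S' e e∈S) j (Walk-mono S⊆S' w)

  Conn-either : ∀ {S x y a b} → (∀ z → Conn G S z x ⊎ Conn G S z y) → ¬ Conn G S a b →
                ∀ z → Conn G S z a ⊎ Conn G S z b
  Conn-either x|y a≁b z with x|y _ | x|y _
  ... | inj₁ a─x | inj₁ b─x = ⊥-elim (a≁b (Conn-trans a─x (Conn-sym b─x)))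
  ... | inj₂ a─y | inj₂ b─y = ⊥-elim (a≁b (Conn-trans a─y (Conn-sym b─y)))
  ... | inj₁ a─x | inj₂ b─y = Sum.map (λ z─x → Conn-trans z─x (Conn-sym a─x)) (λ z─y → Conn-trans z─y (Conn-sym b─y)) (x|y z)
  ... | inj₂ a─y | inj₁ b─x = Sum.swap (Sum.map (λ z─x → Conn-trans z─x (Conn-sym b─x)) (λ z─y → Conn-trans z─y (Conn-sym a─y)) (x|y z))

  module AddEdge {P P' : Fin (m G) → Set} (e₀ : Fin (m G)) (x y : Fin (n G)) (ends-e₀ : ends G e₀ ≡ (x , y))
                 (P'⊆e₀P : ∀ e → P' e → e ≡ e₀ ⊎ P e) (P⊆P' : ∀ e → P e → P' e) (e₀∈P' : P' e₀) where

    Through : Fin (n G) → Fin (n G) → Set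
    Through u v = WalkIn P u v ⊎ (WalkIn P u x × WalkIn P y v) ⊎ (WalkIn P u y × WalkIn P x v)

    walkIn⇒Through : ∀ {u v} → WalkIn P' u v → Through u v
    walkIn⇒Through here = inj₁ here
    walkIn⇒Through (step e pe j p) with walkIn⇒Through p | P'⊆e₀P e pe
    ... | r | inj₂ q with r
    ...   | inj₁ a = inj₁ (step e q j a)
    ...   | inj₂ (inj₁ (a , b)) = inj₂ (inj₁ (step e q j a , b))
    ...   | inj₂ (inj₂ (a , b)) = inj₂ (inj₂ (step e q j a , b))
    walkIn⇒Through (step e pe (inj₁ eq) p) | r | inj₁ refl with trans (sym ends-e₀) eq
    ... | refl with r
    ...   | inj₁ a = inj₂ (inj₁ (here , a))
    ...   | inj₂ (inj₁ (a , b)) = inj₂ (inj₁ (here , b))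
    ...   | inj₂ (inj₂ (a , b)) = inj₁ b
    walkIn⇒Through (step e pe (inj₂ eq) p) | r | inj₁ refl with trans (sym ends-e₀) eq
    ... | refl with r
    ...   | inj₁ a = inj₂ (inj₂ (here , a))
    ...   | inj₂ (inj₁ (a , b)) = inj₁ b
    ...   | inj₂ (inj₂ (a , b)) = inj₂ (inj₂ (here , b))

    Through⇒walkIn : ∀ {u v} → Through u v → WalkIn P' u v
    Through⇒walkIn (inj₁ a) = WalkIn-mono P⊆P' a
    Through⇒walkIn (inj₂ (inj₁ (a , b))) = WalkIn-trans (WalkIn-mono P⊆P' a) (WalkIn-trans x─y (WalkIn-mono P⊆P' b))
      where x─y = step e₀ e₀∈P' (inj₁ ends-e₀) here
    Through⇒walkIn (inj₂ (inj₂ (a , b))) = WalkIn-trans (WalkIn-mono P⊆P' a) (WalkIn-trans y─x (WalkIn-mono P⊆P' b))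
      where y─x = step e₀ e₀∈P' (inj₂ ends-e₀) here

  module _ (S : Subset (m G)) where

    private
      InListAndS : List (Fin (m G)) → Fin (m G) → Set
      InListAndS L e = e ∈ L × InE G e S

      walkIn-[] : ∀ {u v} → WalkIn (InListAndS []) u v → u ≡ v
      walkIn-[] here = refl
      walkIn-[] (step e (() , _) j p)

    -- Reachability is decided by inserting the edges of S one at a time.
    walkIn? : ∀ L u v → Dec (WalkIn (InListAndS L) u v)
    walkIn? [] u v = map′ (λ { refl → here }) walkIn-[] (u ≟ v)
    walkIn? (e₀ ∷ L) u v with lookup S e₀ Boolₚ.≟ true
    ... | no e₀∉S = map′ (WalkIn-mono (λ e (e∈L , e∈S) → there e∈L , e∈S)) (WalkIn-mono drop-e₀) (walkIn? L u v)
      where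
      drop-e₀ : ∀ e → InListAndS (e₀ ∷ L) e → InListAndS L e
      drop-e₀ e (here refl , e∈S) = ⊥-elim (e₀∉S e∈S)
      drop-e₀ e (there e∈L , e∈S) = e∈L , e∈S
    ... | yes e₀∈S = map′ A.Through⇒walkIn A.walkIn⇒Through
                       (walkIn? L u v ⊎-dec ((walkIn? L u x ×-dec walkIn? L y v) ⊎-dec (walkIn? L u y ×-dec walkIn? L x v)))
      where
      x = proj₁ (ends G e₀)
      y = proj₂ (ends G e₀)
      split : ∀ e → InListAndS (e₀ ∷ L) e → e ≡ e₀ ⊎ InListAndS L e
      split e (here refl , _) = inj₁ refl
      split e (there e∈L , e∈S) = inj₂ (e∈L , e∈S)
      module A = AddEdge {InListAndS L} {InListAndS (e₀ ∷ L)} e₀ x y refl split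
                         (λ e (e∈L , e∈S) → there e∈L , e∈S) (here refl , e₀∈S)

    conn? : ∀ u v → Dec (Conn G S u v)
    conn? u v = map′ (λ p → walkIn⇒Conn (WalkIn-mono (λ e → proj₂) p))
                     (λ (_ , w) → WalkIn-mono (λ e e∈S → ∈-allFin e , e∈S) (walk⇒walkIn w))
                     (walkIn? (allFin (m G)) u v)

  walk? : ∀ S u v es → Dec (Walk G S u v es)
  walk? S u v [] = map′ (λ { refl → here }) (λ { here → refl }) (u ≟ v)
  walk? S u v (e ∷ es) with lookup S e Boolₚ.≟ true
  ... | no e∉S = no λ { (step _ e∈S _ _) → e∉S e∈S }
  ... | yes e∈S = map′ (λ (w , j , p) → step e e∈S j p) (λ { (step _ _ j p) → _ , j , p })
                       (Finₚ.any? (λ w → joins? w ×-dec walk? S w v es))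
    where
    joins? : ∀ w → Dec (Joins G e u w)
    joins? w = ≡-dec-pair (ends G e) (u , w) ⊎-dec ≡-dec-pair (ends G e) (w , u)
      where ≡-dec-pair = ×ₚ.≡-dec _≟_ _≟_

  listsUpTo : ℕ → List (List (Fin (m G)))
  listsUpTo zero = [] ∷ []
  listsUpTo (suc k) = [] ∷ List.concatMap (λ e → List.map (e ∷_) (listsUpTo k)) (allFin (m G))

  ∈-listsUpTo : ∀ k es → List.length es ≤ k → es ∈ listsUpTo k
  ∈-listsUpTo zero [] _ = here refl
  ∈-listsUpTo (suc k) [] _ = here refl
  ∈-listsUpTo (suc k) (e ∷ es) (s≤s |es|≤k) =
    there (∈-concatMap⁺ (λ e' → List.map (e' ∷_) (listsUpTo k)) {xs = allFin (m G)}
             (Any.map (λ { refl → ∈-map⁺ (e ∷_) (∈-listsUpTo k es |es|≤k) }) (∈-allFin e)))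

  Unique⇒length≤ : ∀ {es : List (Fin (m G))} → Unique es → List.length es ≤ m G
  Unique⇒length≤ {es} u with List.length es ≤? m G
  ... | yes |es|≤m = |es|≤m
  ... | no |es|≰m with Finₚ.pigeonhole (≰⇒> |es|≰m) (List.lookup es)
  ...   | i , j , i<j , eq = ⊥-elim (<-irrefl (cong Fin.toℕ (lookup-injective u i j eq)) i<j)
    where
    lookup-injective : ∀ {xs : List (Fin (m G))} → Unique xs → ∀ i j → List.lookup xs i ≡ List.lookup xs j → i ≡ j
    lookup-injective (_ ∷ _) Fin.zero Fin.zero _ = refl
    lookup-injective {_ ∷ xs} (x∉xs ∷ _) Fin.zero (Fin.suc j) eq = ⊥-elim (ListAll.lookup x∉xs (∈-lookup {xs = xs} j) eq)
    lookup-injective {_ ∷ xs} (x∉xs ∷ _) (Fin.suc i) Fin.zero eq = ⊥-elim (ListAll.lookup x∉xs (∈-lookup {xs = xs} i) (sym eq))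
    lookup-injective (_ ∷ u) (Fin.suc i) (Fin.suc j) eq = cong Fin.suc (lookup-injective u i j eq)

  -- A closed trail has at most m G edges, so finitely many edge lists need to be checked.
  acyclic? : ∀ S → Dec (Acyclic G S)
  acyclic? S = map′ (λ h v es w u → ListAll.lookup (h v) (∈-listsUpTo (m G) es (Unique⇒length≤ u)) w u)
                    (λ ac v → ListAll.tabulate λ {es} _ → ac v es)
                    (Finₚ.all? λ v → ListAll.all? (λ es → walk? S v v es →-dec (unique? es →-dec []? es)) (listsUpTo (m G)))
    where
    unique? : ∀ (es : List (Fin (m G))) → Dec (Unique es)
    unique? = AllPairs.allPairs? (λ x y → ¬? (x ≟ y))
    []? : ∀ (es : List (Fin (m G))) → Dec (es ≡ [])
    []? [] = yes refl
    []? (_ ∷ _) = no λ ()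

  connected? : ∀ S → Dec (Connected G S)
  connected? S = Finₚ.all? λ u → Finₚ.all? λ v → conn? S u v

  spanningTree? : ∀ S → Dec (SpanningTree G S)
  spanningTree? S = connected? S ×-dec acyclic? S

  spanning2Forest? : ∀ S → Dec (Spanning2Forest G S)
  spanning2Forest? S = acyclic? S ×-dec Finₚ.any? λ x → Finₚ.any? λ y →
    ¬? (conn? S x y) ×-dec Finₚ.all? (λ z → conn? S z x ⊎-dec conn? S z y)

  compatible? : ∀ V P S → Dec (Compatible G V P S)
  compatible? V P S =
    (Finₚ.all? λ a → Finₚ.all? λ a' → inA? a →-dec (inA? a' →-dec conn? S a a')) ×-dec
    (Finₚ.all? λ b → Finₚ.all? λ b' → inB? b →-dec (inB? b' →-dec conn? S b b')) ×-dec
    (Finₚ.all? λ a → Finₚ.all? λ b → inA? a →-dec (inB? b →-dec ¬? (conn? S a b)))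
    where
    inA? : ∀ v → Dec (InA G V P v)
    inA? v = (lookup V v Boolₚ.≟ true) ×-dec (lookup P v Boolₚ.≟ true)
    inB? : ∀ v → Dec (InB G V P v)
    inB? v = (lookup V v Boolₚ.≟ true) ×-dec (lookup P v Boolₚ.≟ false)

  inGP? : ∀ p V Ps t → Dec (InGP G p V Ps t)
  inGP? p V Ps (ψ , φ) =
    (Finₚ.all? λ e → mult G e ψ + mult G e φ ℕₚ.≟ p ∸ 1) ×-dec
    (Finₚ.all? λ j → spanningTree? (lookup ψ j)) ×-dec
    (Finₚ.all? λ j → spanning2Forest? (lookup φ j) ×-dec compatible? V (lookup Ps j) (lookup φ j))

module PendantEdges (G : Graph) (c : Fin (n G)) where

  open Connectivity G

  Isolated : Subset (m G) → Set
  Isolated S = ∀ e w → InE G e S → Joins G e c w → ⊥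

  Pendant : Fin (m G) → Fin (n G) → Set
  Pendant e x = Joins G e c x × x ≢ c

  module _ {S : Subset (m G)} (c-isolated : Isolated S) where

    isolated-walkIn : ∀ {u v} → WalkIn (λ e → InE G e S) u v → u ≡ c → v ≡ c
    isolated-walkIn here u≡c = u≡c
    isolated-walkIn (step e e∈S j p) refl = ⊥-elim (c-isolated e _ e∈S j)

    isolated-walkIn⁻ : ∀ {u v} → WalkIn (λ e → InE G e S) u v → v ≡ c → u ≡ c
    isolated-walkIn⁻ p = isolated-walkIn (WalkIn-sym p)

    isolated-Conn : ∀ {v} → Conn G S c v → v ≡ c
    isolated-Conn (_ , w) = isolated-walkIn (walk⇒walkIn w) refl

  module _ {e x} (pendant : Pendant e x) where

    pendant-ends : ∀ {u w} → Joins G e u w → u ≢ c → u ≡ x × w ≡ c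
    pendant-ends (inj₁ e≡uw) u≢c with proj₁ pendant
    ... | inj₁ e≡cx = ⊥-elim (u≢c (cong proj₁ (trans (sym e≡uw) e≡cx)))
    ... | inj₂ e≡xc = cong proj₁ (trans (sym e≡uw) e≡xc) , cong proj₂ (trans (sym e≡uw) e≡xc)
    pendant-ends (inj₂ e≡wu) u≢c with proj₁ pendant
    ... | inj₁ e≡cx = cong proj₂ (trans (sym e≡wu) e≡cx) , cong proj₁ (trans (sym e≡wu) e≡cx)
    ... | inj₂ e≡xc = ⊥-elim (u≢c (cong proj₂ (trans (sym e≡wu) e≡xc)))

    pendant-from-c : ∀ {w} → Joins G e c w → w ≡ x
    pendant-from-c j with proj₁ pendant | j
    ... | inj₁ e≡cx | inj₁ e≡cw = cong proj₂ (trans (sym e≡cw) e≡cx)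
    ... | inj₁ e≡cx | inj₂ e≡wc = ⊥-elim (proj₂ pendant (cong proj₂ (trans (sym e≡cx) e≡wc)))
    ... | inj₂ e≡xc | inj₁ e≡cw = ⊥-elim (proj₂ pendant (cong proj₁ (trans (sym e≡xc) e≡cw)))
    ... | inj₂ e≡xc | inj₂ e≡wc = cong proj₁ (trans (sym e≡wc) e≡xc)

  module AddPendant {S₀ S : Subset (m G)} (c-isolated : Isolated S₀) {e x} (pendant : Pendant e x)
                    (S⊆e+S₀ : ∀ e' → InE G e' S → e' ≡ e ⊎ InE G e' S₀)
                    (S₀⊆S : ∀ e' → InE G e' S₀ → InE G e' S) (e∈S : InE G e S) where

    leave-c : ∀ {e' w} → InE G e' S → Joins G e' c w → e' ≡ e × w ≡ x
    leave-c {e'} e'∈S j with S⊆e+S₀ e' e'∈S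
    ... | inj₂ e'∈S₀ = ⊥-elim (c-isolated e' _ e'∈S₀ j)
    ... | inj₁ refl = refl , pendant-from-c pendant j

    Conn-c-x : Conn G S c x
    Conn-c-x = walkIn⇒Conn (step e e∈S (proj₁ pendant) here)

    avoids-c : ∀ {e' u w} → InE G e' S₀ → Joins G e' u w → w ≢ c
    avoids-c e'∈S₀ j refl = c-isolated _ _ e'∈S₀ (Joins-sym j)

    -- A walk between vertices other than c that enters c along e must leave along e again, back to x.
    walkIn-restrict : ∀ {u v} → WalkIn (λ e' → InE G e' S) u v → u ≢ c → v ≢ c → WalkIn (λ e' → InE G e' S₀) u v
    walkIn-restrict here u≢c v≢c = here
    walkIn-restrict (step e' e'∈S j p) u≢c v≢c with S⊆e+S₀ e' e'∈S
    ... | inj₂ e'∈S₀ = step e' e'∈S₀ j (walkIn-restrict p (avoids-c e'∈S₀ j) v≢c)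
    ... | inj₁ refl with pendant-ends pendant j u≢c
    ...   | u≡x , refl with p
    ...     | here = ⊥-elim (v≢c refl)
    ...     | step e'' e''∈S j' p' with leave-c e''∈S j'
    ...       | refl , refl = subst (λ z → WalkIn _ z _) (sym u≡x) (walkIn-restrict p' (proj₂ pendant) v≢c)

    Conn-restrict : ∀ {u v} → Conn G S u v → u ≢ c → v ≢ c → Conn G S₀ u v
    Conn-restrict (_ , w) u≢c v≢c = walkIn⇒Conn (walkIn-restrict (walk⇒walkIn w) u≢c v≢c)

    Conn-extend : ∀ {u v} → Conn G S₀ u v → Conn G S u v
    Conn-extend = Conn-mono S₀⊆S

    walk-restrict : ∀ {u v es} → Walk G S u v es → ListAll.All (e ≢_) es → Walk G S₀ u v es
    walk-restrict here _ = here
    walk-restrict (step e' e'∈S j w) (e≢e' ∷ e∉es) with S⊆e+S₀ e' e'∈S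
    ... | inj₁ refl = ⊥-elim (e≢e' refl)
    ... | inj₂ e'∈S₀ = step e' e'∈S₀ j (walk-restrict w e∉es)

    -- A trail cannot pass through c, since it would have to use e twice.
    trail-restrict : ∀ {u v es} → Walk G S u v es → Unique es → u ≢ c → v ≢ c → Walk G S₀ u v es
    trail-restrict here _ _ _ = here
    trail-restrict (step e' e'∈S j w) (e'∉es ∷ u) u≢c v≢c with S⊆e+S₀ e' e'∈S
    ... | inj₂ e'∈S₀ = step e' e'∈S₀ j (trail-restrict w u (avoids-c e'∈S₀ j) v≢c)
    ... | inj₁ refl with pendant-ends pendant j u≢c
    ...   | _ , refl with w
    ...     | here = ⊥-elim (v≢c refl)
    ...     | step e'' e''∈S j' _ with leave-c e''∈S j' | e'∉es
    ...       | refl , refl | e≢e ∷ _ = ⊥-elim (e≢e refl)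

    Acyclic-extend : Acyclic G S₀ → Acyclic G S
    Acyclic-extend acyclic v es w u with v ≟ c
    ... | no v≢c = acyclic v es (trail-restrict w u v≢c v≢c) u
    ... | yes refl with w
    ...   | here = refl
    ...   | step e' e'∈S j w' with leave-c e'∈S j | u
    ...     | refl , refl | e∉es ∷ _ =
      ⊥-elim (proj₂ pendant (isolated-walkIn⁻ {S₀} c-isolated (walk⇒walkIn (walk-restrict w' e∉es)) refl))

    Acyclic-restrict : Acyclic G S → Acyclic G S₀
    Acyclic-restrict acyclic v es w u = acyclic v es (Walk-mono S₀⊆S w) u

  module FlipAtC (V P P' : Subset (n G)) (P'≈P : ∀ u → u ≢ c → lookup P' u ≡ lookup P u)
                 (P'-c : lookup P' c ≡ not (lookup P c))
                 {a} (a∈A : InA G V P a) (a≢c : a ≢ c) {b} (b∈B : InB G V P b) (b≢c : b ≢ c) where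

    CompatibleEither : Subset (m G) → Set
    CompatibleEither S = Compatible G V P S ⊎ Compatible G V P' S

    record CompatibleOff (S : Subset (m G)) : Set where
      field
        A-connected : ∀ {u u'} → u ≢ c → u' ≢ c → InA G V P u → InA G V P u' → Conn G S u u'
        B-connected : ∀ {u u'} → u ≢ c → u' ≢ c → InB G V P u → InB G V P u' → Conn G S u u'
        A-B-separated : ∀ {u w} → u ≢ c → w ≢ c → InA G V P u → InB G V P w → ¬ Conn G S u w

    private module Agreeing (Pt : Subset (n G)) (Pt≈P : ∀ u → u ≢ c → lookup Pt u ≡ lookup P u) where

      toA : ∀ {u} → u ≢ c → InA G V P u → InA G V Pt u
      toA u≢c (u∈V , P-u) = u∈V , trans (Pt≈P _ u≢c) P-u
      toB : ∀ {u} → u ≢ c → InB G V P u → InB G V Pt u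
      toB u≢c (u∈V , P-u) = u∈V , trans (Pt≈P _ u≢c) P-u
      fromA : ∀ {u} → u ≢ c → InA G V Pt u → InA G V P u
      fromA u≢c (u∈V , Pt-u) = u∈V , trans (sym (Pt≈P _ u≢c)) Pt-u
      fromB : ∀ {u} → u ≢ c → InB G V Pt u → InB G V P u
      fromB u≢c (u∈V , Pt-u) = u∈V , trans (sym (Pt≈P _ u≢c)) Pt-u

      compatible⇒Off : ∀ {S} → Compatible G V Pt S → CompatibleOff S
      compatible⇒Off (A-conn , B-conn , separated) = record
        { A-connected = λ u≢c u'≢c u∈A u'∈A → A-conn _ _ (toA u≢c u∈A) (toA u'≢c u'∈A)
        ; B-connected = λ u≢c u'≢c u∈B u'∈B → B-conn _ _ (toB u≢c u∈B) (toB u'≢c u'∈B)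
        ; A-B-separated = λ u≢c w≢c u∈A w∈B → separated _ _ (toA u≢c u∈A) (toB w≢c w∈B)
        }

      compatible-A : ∀ {S} → lookup Pt c ≡ true → CompatibleOff S → Conn G S c a →
                     Compatible G V Pt S
      compatible-A {S} Pt-c off c─a = A-conn , B-conn , separated
        where
        open CompatibleOff off
        to-a : ∀ u → InA G V Pt u → Conn G S u a
        to-a u u∈A with u ≟ c
        ... | yes refl = c─a
        ... | no u≢c = A-connected u≢c a≢c (fromA u≢c u∈A) a∈A
        B∌c : ∀ {u} → InB G V Pt u → u ≢ c
        B∌c (_ , Pt-u) refl with trans (sym Pt-c) Pt-u
        ... | ()
        A-conn : ∀ u u' → InA G V Pt u → InA G V Pt u' → Conn G S u u'
        A-conn u u' u∈A u'∈A = Conn-trans (to-a u u∈A) (Conn-sym (to-a u' u'∈A))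
        B-conn : ∀ u u' → InB G V Pt u → InB G V Pt u' → Conn G S u u'
        B-conn u u' u∈B u'∈B = B-connected (B∌c u∈B) (B∌c u'∈B) (fromB (B∌c u∈B) u∈B) (fromB (B∌c u'∈B) u'∈B)
        separated : ∀ u w → InA G V Pt u → InB G V Pt w → ¬ Conn G S u w
        separated u w u∈A w∈B u─w =
          A-B-separated a≢c (B∌c w∈B) a∈A (fromB (B∌c w∈B) w∈B) (Conn-trans (Conn-sym (to-a u u∈A)) u─w)

      compatible-B : ∀ {S} → lookup Pt c ≡ false → CompatibleOff S → Conn G S c b →
                     Compatible G V Pt S
      compatible-B {S} Pt-c off c─b = A-conn , B-conn , separated
        where
        open CompatibleOff off
        to-b : ∀ u → InB G V Pt u → Conn G S u b
        to-b u u∈B with u ≟ c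
        ... | yes refl = c─b
        ... | no u≢c = B-connected u≢c b≢c (fromB u≢c u∈B) b∈B
        A∌c : ∀ {u} → InA G V Pt u → u ≢ c
        A∌c (_ , Pt-u) refl with trans (sym Pt-c) Pt-u
        ... | ()
        A-conn : ∀ u u' → InA G V Pt u → InA G V Pt u' → Conn G S u u'
        A-conn u u' u∈A u'∈A = A-connected (A∌c u∈A) (A∌c u'∈A) (fromA (A∌c u∈A) u∈A) (fromA (A∌c u'∈A) u'∈A)
        B-conn : ∀ u u' → InB G V Pt u → InB G V Pt u' → Conn G S u u'
        B-conn u u' u∈B u'∈B = Conn-trans (to-b u u∈B) (Conn-sym (to-b u' u'∈B))
        separated : ∀ u w → InA G V Pt u → InB G V Pt w → ¬ Conn G S u w
        separated u w u∈A w∈B u─w =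
          A-B-separated (A∌c u∈A) b≢c (fromA (A∌c u∈A) u∈A) b∈B (Conn-trans u─w (to-b w w∈B))

    CompatibleEither⇒Off : ∀ {S} → CompatibleEither S → CompatibleOff S
    CompatibleEither⇒Off (inj₁ compatible) = Agreeing.compatible⇒Off P (λ _ _ → refl) compatible
    CompatibleEither⇒Off (inj₂ compatible) = Agreeing.compatible⇒Off P' P'≈P compatible

    -- Whichever of P and P' puts c on the side of the component containing c is compatible.
    Off⇒CompatibleEither : ∀ {S} → CompatibleOff S → Conn G S c a ⊎ Conn G S c b → CompatibleEither S
    Off⇒CompatibleEither off c─a|c─b with c─a|c─b | lookup P c in P-c
    ... | inj₁ c─a | true = inj₁ (Agreeing.compatible-A P (λ _ _ → refl) P-c off c─a)
    ... | inj₁ c─a | false = inj₂ (Agreeing.compatible-A P' P'≈P (trans P'-c (cong not P-c)) off c─a)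
    ... | inj₂ c─b | false = inj₁ (Agreeing.compatible-B P (λ _ _ → refl) P-c off c─b)
    ... | inj₂ c─b | true = inj₂ (Agreeing.compatible-B P' P'≈P (trans P'-c (cong not P-c)) off c─b)

    CompatibleOff-transfer : ∀ {S S'} → (∀ {u v} → Conn G S u v → u ≢ c → v ≢ c → Conn G S' u v) →
      (∀ {u v} → Conn G S' u v → u ≢ c → v ≢ c → Conn G S u v) → CompatibleOff S → CompatibleOff S'
    CompatibleOff-transfer to from off = record
      { A-connected = λ u≢c u'≢c u∈A u'∈A → to (A-connected u≢c u'≢c u∈A u'∈A) u≢c u'≢c
      ; B-connected = λ u≢c u'≢c u∈B u'∈B → to (B-connected u≢c u'≢c u∈B u'∈B) u≢c u'≢c
      ; A-B-separated = λ u≢c w≢c u∈A w∈B u─w → A-B-separated u≢c w≢c u∈A w∈B (from u─w u≢c w≢c)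
      }
      where open CompatibleOff off

  module SwapPendant {S₀ S₁ S₂ : Subset (m G)} (c-isolated : Isolated S₀)
           {e₁ x₁} (pendant₁ : Pendant e₁ x₁) (S₁⊆e₁+S₀ : ∀ e → InE G e S₁ → e ≡ e₁ ⊎ InE G e S₀)
           (S₀⊆S₁ : ∀ e → InE G e S₀ → InE G e S₁) (e₁∈S₁ : InE G e₁ S₁)
           {e₂ x₂} (pendant₂ : Pendant e₂ x₂) (S₂⊆e₂+S₀ : ∀ e → InE G e S₂ → e ≡ e₂ ⊎ InE G e S₀)
           (S₀⊆S₂ : ∀ e → InE G e S₀ → InE G e S₂) (e₂∈S₂ : InE G e₂ S₂) where

    private
      module P₁ = AddPendant {S₀} {S₁} c-isolated pendant₁ S₁⊆e₁+S₀ S₀⊆S₁ e₁∈S₁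
      module P₂ = AddPendant {S₀} {S₂} c-isolated pendant₂ S₂⊆e₂+S₀ S₀⊆S₂ e₂∈S₂

    Conn-swap : ∀ {u v} → Conn G S₁ u v → u ≢ c → v ≢ c → Conn G S₂ u v
    Conn-swap p u≢c v≢c = P₂.Conn-extend (P₁.Conn-restrict p u≢c v≢c)

    Conn-swap⁻ : ∀ {u v} → Conn G S₂ u v → u ≢ c → v ≢ c → Conn G S₁ u v
    Conn-swap⁻ p u≢c v≢c = P₁.Conn-extend (P₂.Conn-restrict p u≢c v≢c)

    Acyclic-swap : Acyclic G S₁ → Acyclic G S₂
    Acyclic-swap acyclic = P₂.Acyclic-extend (P₁.Acyclic-restrict acyclic)

    Conn-c-swap : ∀ {v} → Conn G S₁ x₂ v → v ≢ c → Conn G S₂ c v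
    Conn-c-swap p v≢c = Conn-trans P₂.Conn-c-x (Conn-swap p (proj₂ pendant₂) v≢c)

    SpanningTree-swap : SpanningTree G S₁ → SpanningTree G S₂
    SpanningTree-swap (connected , acyclic) = connected₂ , Acyclic-swap acyclic
      where
      c─v : ∀ v → v ≢ c → Conn G S₂ c v
      c─v v v≢c = Conn-c-swap (connected x₂ v) v≢c
      connected₂ : Connected G S₂
      connected₂ u v with u ≟ c | v ≟ c
      ... | yes refl | yes refl = Conn-refl
      ... | yes refl | no v≢c = c─v v v≢c
      ... | no u≢c | yes refl = Conn-sym (c─v u u≢c)
      ... | no u≢c | no v≢c = Conn-swap (connected u v) u≢c v≢c

    module _ (V P P' : Subset (n G)) (P'≈P : ∀ u → u ≢ c → lookup P' u ≡ lookup P u)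
             (P'-c : lookup P' c ≡ not (lookup P c))
             {a} (a∈A : InA G V P a) (a≢c : a ≢ c) {b} (b∈B : InB G V P b) (b≢c : b ≢ c) where

      open FlipAtC V P P' P'≈P P'-c a∈A a≢c b∈B b≢c

      compatible2Forest-swap : Spanning2Forest G S₁ × CompatibleEither S₁ → Spanning2Forest G S₂ × CompatibleEither S₂
      compatible2Forest-swap ((acyclic , _ , _ , _ , x|y) , compatible) =
        (Acyclic-swap acyclic , a , b , a≁b , a|b) , Off⇒CompatibleEither off₂ (a|b c)
        where
        off₁ = CompatibleEither⇒Off compatible
        off₂ = CompatibleOff-transfer Conn-swap Conn-swap⁻ off₁
        a|b₁ : ∀ z → Conn G S₁ z a ⊎ Conn G S₁ z b
        a|b₁ = Conn-either x|y (CompatibleOff.A-B-separated off₁ a≢c b≢c a∈A b∈B)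
        a≁b : ¬ Conn G S₂ a b
        a≁b = CompatibleOff.A-B-separated off₂ a≢c b≢c a∈A b∈B
        a|b : ∀ z → Conn G S₂ z a ⊎ Conn G S₂ z b
        a|b z with z ≟ c
        ... | no z≢c = Sum.map (λ z─a → Conn-swap z─a z≢c a≢c) (λ z─b → Conn-swap z─b z≢c b≢c) (a|b₁ z)
        ... | yes refl = Sum.map (λ x₂─a → Conn-c-swap x₂─a a≢c) (λ x₂─b → Conn-c-swap x₂─b b≢c) (a|b₁ x₂)

  private
    incidences : Fin (m G) → ℕ
    incidences e = bit G (does (proj₁ (ends G e) ≟ c)) + bit G (does (proj₂ (ends G e) ≟ c))

    incidences≡1 : ∀ e → incidences e ≡ 1 → ∃[ x ] Pendant e x
    incidences≡1 e eq with proj₁ (ends G e) ≟ c | proj₂ (ends G e) ≟ c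
    ... | yes refl | no y≢c = proj₂ (ends G e) , inj₁ refl , y≢c
    ... | no x≢c | yes refl = proj₁ (ends G e) , inj₂ refl , x≢c
    incidences≡1 e () | yes _ | yes _
    incidences≡1 e () | no _ | no _

    incidences≡0 : ∀ e → incidences e ≡ 0 → proj₁ (ends G e) ≢ c × proj₂ (ends G e) ≢ c
    incidences≡0 e eq with proj₁ (ends G e) ≟ c | proj₂ (ends G e) ≟ c
    ... | no x≢c | no y≢c = x≢c , y≢c
    incidences≡0 e () | yes _ | _
    incidences≡0 e () | no _ | yes _

    2≤incidences : ∀ e → 2 ≤ incidences e → ends G e ≡ (c , c)
    2≤incidences e le with proj₁ (ends G e) ≟ c | proj₂ (ends G e) ≟ c
    ... | yes x≡c | yes y≡c = cong₂ _,_ x≡c y≡c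
    2≤incidences e (s≤s ()) | yes _ | no _
    2≤incidences e (s≤s ()) | no _ | yes _
    2≤incidences e () | no _ | no _

  record TwoPendants : Set where
    field
      e₁ e₂ : Fin (m G)
      x₁ x₂ : Fin (n G)
      e₁≢e₂ : e₁ ≢ e₂
      pendant₁ : Pendant e₁ x₁
      pendant₂ : Pendant e₂ x₂
      others-avoid-c : ∀ e → e ≢ e₁ → e ≢ e₂ → proj₁ (ends G e) ≢ c × proj₂ (ends G e) ≢ c

  degree≡2⇒loop⊎TwoPendants : degree G c ≡ 2 → (∃[ e ] ends G e ≡ (c , c)) ⊎ TwoPendants
  degree≡2⇒loop⊎TwoPendants deg≡2 with sum≡2⇒ incidences deg≡2
  ... | inj₁ (e , 2≤) = inj₁ (e , 2≤incidences e 2≤)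
  ... | inj₂ (e₁ , e₂ , e₁≢e₂ , one₁ , one₂ , rest) with incidences≡1 e₁ one₁ | incidences≡1 e₂ one₂
  ...   | x₁ , pendant₁ | x₂ , pendant₂ = inj₂ (record
          { e₁ = e₁ ; e₂ = e₂ ; x₁ = x₁ ; x₂ = x₂ ; e₁≢e₂ = e₁≢e₂ ; pendant₁ = pendant₁ ; pendant₂ = pendant₂
          ; others-avoid-c = λ e e≢e₁ e≢e₂ → incidences≡0 e (rest e e≢e₁ e≢e₂) })

module _ (G : Graph) where

  mult≡0 : ∀ {k} e (Ss : Vec (Subset (m G)) k) → (∀ j → lookup (lookup Ss j) e ≢ true) → mult G e Ss ≡ 0
  mult≡0 e [] _ = refl
  mult≡0 e (S ∷ Ss) e∉Ss with lookup S e in e∈S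
  ... | true = ⊥-elim (e∉Ss Fin.zero e∈S)
  ... | false = mult≡0 e Ss (e∉Ss ∘ Fin.suc)

  loop-∉-acyclic : ∀ {S e v} → ends G e ≡ (v , v) → Acyclic G S → lookup S e ≢ true
  loop-∉-acyclic {e = e} {v} loop acyclic e∈S
    with acyclic v (e ∷ []) (step e e∈S (inj₁ loop) here) ([] ∷ [])
  ... | ()

  -- The loop would have to lie in one of the 2(p - 1) ≥ 2 acyclic subgraphs.
  loop⇒¬InGP : ∀ {e v} → ends G e ≡ (v , v) → ∀ {k} V Ps t → ¬ InGP G (suc (suc k)) V Ps t
  loop⇒¬InGP {e} loop V Ps (ψ , φ) (multiplicity , trees , forests) with
    trans (sym (cong₂ _+_ (mult≡0 e ψ λ j → loop-∉-acyclic loop (proj₂ (trees j)))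
                          (mult≡0 e φ λ j → loop-∉-acyclic loop (proj₁ (proj₁ (forests j))))))
          (multiplicity e)
  ... | ()

module Flipped (G : Graph) (V : Subset (n G)) (c : Fin (n G)) (c∈V : lookup V c ≡ true)
  {q : ℕ} (Ps : Vec (Subset (n G)) q)
  (A∖c : ∀ j → ∃[ v ] (lookup V v ≡ true × v ≢ c × lookup (lookup Ps j) v ≡ true))
  (B∖c : ∀ j → ∃[ v ] (lookup V v ≡ true × v ≢ c × lookup (lookup Ps j) v ≡ false))
  (i : Fin q) where

  open Connectivity G
  open PendantEdges G c

  Ps' : Vec (Subset (n G)) q
  Ps' = Ps [ i ]≔ flipAt G c (lookup Ps i)

  Ps'-other : ∀ {j} → j ≢ i → lookup Ps' j ≡ lookup Ps j
  Ps'-other j≢i = Vecₚ.lookup∘update′ j≢i Ps _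

  Ps'-agrees : ∀ j u → u ≢ c → lookup (lookup Ps' j) u ≡ lookup (lookup Ps j) u
  Ps'-agrees j u u≢c with j ≟ i
  ... | no j≢i = cong (λ P → lookup P u) (Ps'-other j≢i)
  ... | yes refl = trans (cong (λ P → lookup P u) (Vecₚ.lookup∘update i Ps _))
                         (Vecₚ.lookup∘updateAt′ u c u≢c (lookup Ps i))

  Ps'-flips : lookup (lookup Ps' i) c ≡ not (lookup (lookup Ps i) c)
  Ps'-flips = trans (cong (λ P → lookup P c) (Vecₚ.lookup∘update i Ps _)) (Vecₚ.lookup∘updateAt c (lookup Ps i))

  InGP-disjoint : ∀ t → InGP G (suc q) V Ps t → InGP G (suc q) V Ps' t → ⊥
  InGP-disjoint t (_ , _ , forests) (_ , _ , forests') with forests i | forests' i | lookup (lookup Ps i) c in Pc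
  ... | _ , A-conn , _ , _ | _ , _ , _ , separated' | true with A∖c i
  ...   | a , a∈V , a≢c , Pa = separated' a c (a∈V , trans (Ps'-agrees i a a≢c) Pa) (c∈V , trans Ps'-flips (cong not Pc))
                                 (A-conn a c (a∈V , Pa) (c∈V , Pc))
  InGP-disjoint t (_ , _ , forests) (_ , _ , forests') | _ , _ , B-conn , _ | _ , _ , _ , separated' | false with B∖c i
  ...   | b , b∈V , b≢c , Pb = separated' c b (c∈V , trans Ps'-flips (cong not Pc)) (b∈V , trans (Ps'-agrees i b b≢c) Pb)
                                 (B-conn c b (c∈V , Pc) (b∈V , Pb))

  EitherForest : Fin q → Subset (m G) → Set
  EitherForest j S = Spanning2Forest G S × (Compatible G V (lookup Ps j) S ⊎ Compatible G V (lookup Ps' j) S)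

  eitherForest? : ∀ j S → Dec (EitherForest j S)
  eitherForest? j S = spanning2Forest? S ×-dec (compatible? V (lookup Ps j) S ⊎-dec compatible? V (lookup Ps' j) S)

  InUnion : Conf G (suc q) → Set
  InUnion (ψ , φ) = (∀ e → mult G e ψ + mult G e φ ≡ q) × (∀ j → SpanningTree G (lookup ψ j)) × (∀ j → EitherForest j (lookup φ j))

  InGP⇒InUnion : ∀ t → InGP G (suc q) V Ps t ⊎ InGP G (suc q) V Ps' t → InUnion t
  InGP⇒InUnion t (inj₁ (multiplicity , trees , forests)) = multiplicity , trees , λ j → proj₁ (forests j) , inj₁ (proj₂ (forests j))
  InGP⇒InUnion t (inj₂ (multiplicity , trees , forests)) = multiplicity , trees , λ j → proj₁ (forests j) , inj₂ (proj₂ (forests j))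

  -- For j ≢ i the two alternatives coincide, so the i-th forest decides between Ps and Ps'.
  InUnion⇒InGP : ∀ t → InUnion t → InGP G (suc q) V Ps t ⊎ InGP G (suc q) V Ps' t
  InUnion⇒InGP (ψ , φ) (multiplicity , trees , forests) with proj₂ (forests i)
  ... | inj₁ compatible-i = inj₁ (multiplicity , trees , λ j → proj₁ (forests j) , compatible j)
    where
    compatible : ∀ j → Compatible G V (lookup Ps j) (lookup φ j)
    compatible j with j ≟ i | proj₂ (forests j)
    ... | yes refl | _ = compatible-i
    ... | no _ | inj₁ compatible-j = compatible-j
    ... | no j≢i | inj₂ compatible-j = subst (λ P → Compatible G V P (lookup φ j)) (Ps'-other j≢i) compatible-j
  ... | inj₂ compatible-i = inj₂ (multiplicity , trees , λ j → proj₁ (forests j) , compatible j)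
    where
    compatible : ∀ j → Compatible G V (lookup Ps' j) (lookup φ j)
    compatible j with j ≟ i | proj₂ (forests j)
    ... | yes refl | _ = compatible-i
    ... | no _ | inj₂ compatible-j = compatible-j
    ... | no j≢i | inj₁ compatible-j = subst (λ P → Compatible G V P (lookup φ j)) (sym (Ps'-other j≢i)) compatible-j

  tree⇒¬Isolated : ∀ {S} → SpanningTree G S → ¬ Isolated S
  tree⇒¬Isolated (connected , _) c-isolated with A∖c i
  ... | a , _ , a≢c , _ = a≢c (isolated-Conn c-isolated (connected c a))

  -- c lies in some part of the bipartition, which also contains a marked vertex other than c.
  forest⇒¬Isolated : ∀ {j S} → EitherForest j S → ¬ Isolated S
  forest⇒¬Isolated {j} {S} (_ , compatible) c-isolated =
    Sum.[ reaches-c (lookup Ps j) (λ _ _ → refl) , reaches-c (lookup Ps' j) (Ps'-agrees j) ] compatible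
    where
    reaches-c : ∀ P → (∀ u → u ≢ c → lookup P u ≡ lookup (lookup Ps j) u) → Compatible G V P S → ⊥
    reaches-c P P≈Ps-j (A-conn , B-conn , _) with lookup P c in Pc
    ... | true with A∖c j
    ...   | a , a∈V , a≢c , Pa = a≢c (isolated-Conn c-isolated (A-conn c a (c∈V , Pc) (a∈V , trans (P≈Ps-j a a≢c) Pa)))
    reaches-c P P≈Ps-j (A-conn , B-conn , _) | false with B∖c j
    ...   | b , b∈V , b≢c , Pb = b≢c (isolated-Conn c-isolated (B-conn c b (c∈V , Pc) (b∈V , trans (P≈Ps-j b b≢c) Pb)))

module TwoPendantCase (G : Graph) (V : Subset (n G)) (c : Fin (n G)) (c∈V : lookup V c ≡ true)
  {q : ℕ} (p-prime : Prime (suc q)) (Ps : Vec (Subset (n G)) q)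
  (A∖c : ∀ j → ∃[ v ] (lookup V v ≡ true × v ≢ c × lookup (lookup Ps j) v ≡ true))
  (B∖c : ∀ j → ∃[ v ] (lookup V v ≡ true × v ≢ c × lookup (lookup Ps j) v ≡ false))
  (i : Fin q) (pendants : PendantEdges.TwoPendants G c) where

  open Connectivity G
  open PendantEdges G c
  open Flipped G V c c∈V Ps A∖c B∖c i
  open TwoPendants pendants

  set : Subset (m G) → Bool → Bool → Subset (m G)
  set S x y = (S [ e₁ ]≔ x) [ e₂ ]≔ y

  lookup-set-e₁ : ∀ S x y → lookup (set S x y) e₁ ≡ x
  lookup-set-e₁ S x y = trans (Vecₚ.lookup∘update′ e₁≢e₂ (S [ e₁ ]≔ x) y) (Vecₚ.lookup∘update e₁ S x)

  lookup-set-e₂ : ∀ S x y → lookup (set S x y) e₂ ≡ y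
  lookup-set-e₂ S x y = Vecₚ.lookup∘update e₂ (S [ e₁ ]≔ x) y

  lookup-set-other : ∀ S x y {e} → e ≢ e₁ → e ≢ e₂ → lookup (set S x y) e ≡ lookup S e
  lookup-set-other S x y e≢e₁ e≢e₂ = trans (Vecₚ.lookup∘update′ e≢e₂ (S [ e₁ ]≔ x) y) (Vecₚ.lookup∘update′ e≢e₁ S x)

  ≡-by-e₁-e₂-others : ∀ {S S' : Subset (m G)} → lookup S e₁ ≡ lookup S' e₁ → lookup S e₂ ≡ lookup S' e₂ →
    (∀ e → e ≢ e₁ → e ≢ e₂ → lookup S e ≡ lookup S' e) → S ≡ S'
  ≡-by-e₁-e₂-others {S} {S'} at-e₁ at-e₂ elsewhere = Pointwise-≡⇒≡ (ext pointwise)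
    where
    pointwise : ∀ e → lookup S e ≡ lookup S' e
    pointwise e with e ≟ e₁ | e ≟ e₂
    ... | yes refl | _ = at-e₁
    ... | no _ | yes refl = at-e₂
    ... | no e≢e₁ | no e≢e₂ = elsewhere e e≢e₁ e≢e₂

  set-set : ∀ S x y x' y' → set (set S x y) x' y' ≡ set S x' y'
  set-set S x y x' y' = ≡-by-e₁-e₂-others {set (set S x y) x' y'} {set S x' y'}
    (trans (lookup-set-e₁ (set S x y) x' y') (sym (lookup-set-e₁ S x' y')))
    (trans (lookup-set-e₂ (set S x y) x' y') (sym (lookup-set-e₂ S x' y')))
    (λ e e≢e₁ e≢e₂ → trans (lookup-set-other (set S x y) x' y' e≢e₁ e≢e₂)
                      (trans (lookup-set-other S x y e≢e₁ e≢e₂) (sym (lookup-set-other S x' y' e≢e₁ e≢e₂))))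

  set-lookup : ∀ S → set S (lookup S e₁) (lookup S e₂) ≡ S
  set-lookup S = ≡-by-e₁-e₂-others {set S (lookup S e₁) (lookup S e₂)} {S} (lookup-set-e₁ S _ _) (lookup-set-e₂ S _ _) (λ e → lookup-set-other S _ _)

  put : Subset (m G) → Bool → Subset (m G)
  put S x = set S x (not x)

  erase : Subset (m G) → Subset (m G)
  erase S = set S false false

  put-erase : ∀ S → lookup S e₂ ≡ not (lookup S e₁) → put (erase S) (lookup S e₁) ≡ S
  put-erase S e₂≡¬e₁ = begin
    set (set S false false) (lookup S e₁) (not (lookup S e₁)) ≡⟨ set-set S false false _ _ ⟩
    set S (lookup S e₁) (not (lookup S e₁))                   ≡⟨ cong (set S _) e₂≡¬e₁ ⟨
    set S (lookup S e₁) (lookup S e₂)                         ≡⟨ set-lookup S ⟩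
    S ∎
    where open ≡-Reasoning

  isolated-without-e₁-e₂ : ∀ {S} → lookup S e₁ ≡ false → lookup S e₂ ≡ false → Isolated S
  isolated-without-e₁-e₂ {S} e₁∉S e₂∉S e w e∈S j with e ≟ e₁ | e ≟ e₂
  ... | yes refl | _ = case trans (sym e∈S) e₁∉S of λ ()
  ... | no _ | yes refl = case trans (sym e∈S) e₂∉S of λ ()
  ... | no e≢e₁ | no e≢e₂ with j
  ...   | inj₁ e≡cw = proj₁ (others-avoid-c e e≢e₁ e≢e₂) (cong proj₁ e≡cw)
  ...   | inj₂ e≡wc = proj₂ (others-avoid-c e e≢e₁ e≢e₂) (cong proj₂ e≡wc)

  erase-isolated : ∀ S → Isolated (erase S)
  erase-isolated S = isolated-without-e₁-e₂ {erase S} (lookup-set-e₁ S false false) (lookup-set-e₂ S false false)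

  erase⊆put : ∀ S x e → InE G e (erase S) → InE G e (put S x)
  erase⊆put S x e e∈S with e ≟ e₁ | e ≟ e₂
  ... | yes refl | _ = case trans (sym e∈S) (lookup-set-e₁ S false false) of λ ()
  ... | no _ | yes refl = case trans (sym e∈S) (lookup-set-e₂ S false false) of λ ()
  ... | no e≢e₁ | no e≢e₂ = trans (lookup-set-other S _ _ e≢e₁ e≢e₂) (trans (sym (lookup-set-other S _ _ e≢e₁ e≢e₂)) e∈S)

  put⊆pendant+erase : ∀ S x e → InE G e (put S x) → e ≡ (if x then e₁ else e₂) ⊎ InE G e (erase S)
  put⊆pendant+erase S x e e∈S with e ≟ e₁ | e ≟ e₂ | x
  ... | yes refl | _ | true = inj₁ refl
  ... | yes refl | _ | false = case trans (sym e∈S) (lookup-set-e₁ S false true) of λ ()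
  ... | no _ | yes refl | false = inj₁ refl
  ... | no _ | yes refl | true = case trans (sym e∈S) (lookup-set-e₂ S true false) of λ ()
  ... | no e≢e₁ | no e≢e₂ | _ = inj₂ (trans (lookup-set-other S _ _ e≢e₁ e≢e₂) (trans (sym (lookup-set-other S _ _ e≢e₁ e≢e₂)) e∈S))

  module Swap (S : Subset (m G)) = SwapPendant {erase S} {put S true} {put S false} (erase-isolated S)
    pendant₁ (put⊆pendant+erase S true) (erase⊆put S true) (lookup-set-e₁ S true false)
    pendant₂ (put⊆pendant+erase S false) (erase⊆put S false) (lookup-set-e₂ S false true)

  module Swap⁻ (S : Subset (m G)) = SwapPendant {erase S} {put S false} {put S true} (erase-isolated S)
    pendant₂ (put⊆pendant+erase S false) (erase⊆put S false) (lookup-set-e₂ S false true)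
    pendant₁ (put⊆pendant+erase S true) (erase⊆put S true) (lookup-set-e₁ S true false)

  SpanningTree-put : ∀ S → SpanningTree G (put S true) ⇔ SpanningTree G (put S false)
  SpanningTree-put S = mk⇔ (Swap.SpanningTree-swap S) (Swap⁻.SpanningTree-swap S)

  EitherForest-put : ∀ S → EitherForest i (put S true) ⇔ EitherForest i (put S false)
  EitherForest-put S with A∖c i | B∖c i
  ... | a , a∈V , a≢c , Pa | b , b∈V , b≢c , Pb = mk⇔
    (Swap.compatible2Forest-swap S V (lookup Ps i) (lookup Ps' i) (Ps'-agrees i) Ps'-flips (a∈V , Pa) a≢c (b∈V , Pb) b≢c)
    (Swap⁻.compatible2Forest-swap S V (lookup Ps i) (lookup Ps' i) (Ps'-agrees i) Ps'-flips (a∈V , Pa) a≢c (b∈V , Pb) b≢c)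

  treeRestrictions : Conf G (suc q) → Vec (Bool × Bool) q
  treeRestrictions (ψ , _) = Vec.tabulate λ j → restriction λ x → spanningTree? (put (lookup ψ j) x)

  forestRestrictions : Conf G (suc q) → Vec (Bool × Bool) q
  forestRestrictions (_ , φ) = Vec.tabulate λ j → restriction λ x → eitherForest? j (put (lookup φ j) x)

  applyPair : Conf G (suc q) → Vec Bool q → Vec Bool q → Conf G (suc q)
  applyPair (ψ , φ) wψ wφ = Vec.zipWith put ψ wψ , Vec.zipWith put φ wφ

  OffPendantMultiplicities : Conf G (suc q) → Set
  OffPendantMultiplicities (ψ , φ) = ∀ e → e ≢ e₁ → e ≢ e₂ → mult G e ψ + mult G e φ ≡ q

  mult-e₁-put : ∀ {K} (Ss : Vec (Subset (m G)) K) ws → mult G e₁ (Vec.zipWith put Ss ws) ≡ trues ws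
  mult-e₁-put [] [] = refl
  mult-e₁-put (S ∷ Ss) (x ∷ ws) rewrite lookup-set-e₁ S x (not x) with x
  ... | true = cong suc (mult-e₁-put Ss ws)
  ... | false = mult-e₁-put Ss ws

  mult-e₂-put : ∀ {K} (Ss : Vec (Subset (m G)) K) ws → mult G e₂ (Vec.zipWith put Ss ws) ≡ falses ws
  mult-e₂-put [] [] = refl
  mult-e₂-put (S ∷ Ss) (x ∷ ws) rewrite lookup-set-e₂ S x (not x) with x
  ... | true = mult-e₂-put Ss ws
  ... | false = cong suc (mult-e₂-put Ss ws)

  mult-put-other : ∀ {K} (Ss : Vec (Subset (m G)) K) ws {e} → e ≢ e₁ → e ≢ e₂ → mult G e (Vec.zipWith put Ss ws) ≡ mult G e Ss
  mult-put-other [] [] _ _ = refl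
  mult-put-other (S ∷ Ss) (x ∷ ws) e≢e₁ e≢e₂ =
    cong₂ _+_ (cong (bit G) (lookup-set-other S x (not x) e≢e₁ e≢e₂)) (mult-put-other Ss ws e≢e₁ e≢e₂)

  falses+falses≡ : ∀ (wψ wφ : Vec Bool q) → trues wψ + trues wφ ≡ q → falses wψ + falses wφ ≡ q
  falses+falses≡ wψ wφ trues≡q = +-cancelˡ-≡ q _ _ (begin
    q + (falses wψ + falses wφ)                         ≡⟨ cong (_+ (falses wψ + falses wφ)) trues≡q ⟨
    (trues wψ + trues wφ) + (falses wψ + falses wφ)     ≡⟨ +-interchange (trues wψ) _ _ _ ⟩
    (trues wψ + falses wψ) + (trues wφ + falses wφ)     ≡⟨ cong₂ _+_ (trues+falses≡length wψ) (trues+falses≡length wφ) ⟩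
    q + q                                               ∎)
    where open ≡-Reasoning

  ∀-zipWith : ∀ {K} {A B C : Set} {P : Fin K → C → Set} (f : A → B → C) (xs : Vec A K) (ys : Vec B K) →
    (∀ j → P j (lookup (Vec.zipWith f xs ys) j)) ⇔ (∀ j → P j (f (lookup xs j) (lookup ys j)))
  ∀-zipWith {P = P} f xs ys = mk⇔ (λ h j → subst (P j) (Vecₚ.lookup-zipWith f j xs ys) (h j))
                                  (λ h j → subst (P j) (sym (Vecₚ.lookup-zipWith f j xs ys)) (h j))

  InUnion-applyPair : ∀ β wψ wφ → OffPendantMultiplicities β →
    InUnion (applyPair β wψ wφ) ⇔ (Allowed (treeRestrictions β) wψ × Allowed (forestRestrictions β) wφ × trues wψ + trues wφ ≡ q)
  InUnion-applyPair (ψ , φ) wψ wφ off = mk⇔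
    (λ (multiplicity , trees , forests) →
       Equivalence.from trees⇔ (Equivalence.to (∀-zipWith {P = λ _ → SpanningTree G} put ψ wψ) trees) ,
       Equivalence.from forests⇔ (Equivalence.to (∀-zipWith {P = EitherForest} put φ wφ) forests) ,
       trans (sym (cong₂ _+_ (mult-e₁-put ψ wψ) (mult-e₁-put φ wφ))) (multiplicity e₁))
    (λ (trees , forests , trues≡q) →
       multiplicity trues≡q ,
       Equivalence.from (∀-zipWith {P = λ _ → SpanningTree G} put ψ wψ) (Equivalence.to trees⇔ trees) ,
       Equivalence.from (∀-zipWith {P = EitherForest} put φ wφ) (Equivalence.to forests⇔ forests))
    where
    trees⇔ = Allowed-restrictions (λ j x → spanningTree? (put (lookup ψ j) x)) wψ
    forests⇔ = Allowed-restrictions (λ j x → eitherForest? j (put (lookup φ j) x)) wφ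
    multiplicity : trues wψ + trues wφ ≡ q → ∀ e → mult G e (Vec.zipWith put ψ wψ) + mult G e (Vec.zipWith put φ wφ) ≡ q
    multiplicity trues≡q e with e ≟ e₁ | e ≟ e₂
    ... | yes refl | _ = trans (cong₂ _+_ (mult-e₁-put ψ wψ) (mult-e₁-put φ wφ)) trues≡q
    ... | no _ | yes refl = trans (cong₂ _+_ (mult-e₂-put ψ wψ) (mult-e₂-put φ wφ)) (falses+falses≡ wψ wφ trues≡q)
    ... | no e≢e₁ | no e≢e₂ = trans (cong₂ _+_ (mult-put-other ψ wψ e≢e₁ e≢e₂) (mult-put-other φ wφ e≢e₁ e≢e₂)) (off e e≢e₁ e≢e₂)

  ExactlyOnePendant : Subset (m G) → Set
  ExactlyOnePendant S = lookup S e₂ ≡ not (lookup S e₁)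

  pendantCount : Subset (m G) → ℕ
  pendantCount S = bit G (lookup S e₁) + bit G (lookup S e₂)

  sum-pendantCount : ∀ {K} (Ss : Vec (Subset (m G)) K) → Vec.sum (Vec.map pendantCount Ss) ≡ mult G e₁ Ss + mult G e₂ Ss
  sum-pendantCount [] = refl
  sum-pendantCount (S ∷ Ss) = trans (cong (pendantCount S +_) (sum-pendantCount Ss))
                                    (+-interchange (bit G (lookup S e₁)) (bit G (lookup S e₂)) _ _)

  ¬Isolated⇒1≤pendantCount : ∀ S → ¬ Isolated S → 1 ≤ pendantCount S
  ¬Isolated⇒1≤pendantCount S ¬isolated with lookup S e₁ in S-e₁ | lookup S e₂ in S-e₂
  ... | true | _ = s≤s z≤n
  ... | false | true = s≤s z≤n
  ... | false | false = ⊥-elim (¬isolated (isolated-without-e₁-e₂ {S} S-e₁ S-e₂))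

  pendantCount≡1 : ∀ S → pendantCount S ≡ 1 → ExactlyOnePendant S
  pendantCount≡1 S count≡1 with lookup S e₁ | lookup S e₂
  ... | true | false = refl
  ... | false | true = refl
  pendantCount≡1 S () | true | true
  pendantCount≡1 S () | false | false

  -- Each of the 2q subgraphs contains e₁ or e₂, and these two edges occur 2q times in total.
  InUnion⇒ExactlyOnePendant : ∀ {ψ φ} → InUnion (ψ , φ) →
    (∀ j → ExactlyOnePendant (lookup ψ j)) × (∀ j → ExactlyOnePendant (lookup φ j))
  InUnion⇒ExactlyOnePendant {ψ} {φ} (multiplicity , trees , forests) = exactlyOne ψ 1≤ψ Σψ≡q , exactlyOne φ 1≤φ Σφ≡q
    where
    1≤ψ : ∀ j → 1 ≤ lookup (Vec.map pendantCount ψ) j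
    1≤ψ j = subst (1 ≤_) (sym (Vecₚ.lookup-map j pendantCount ψ)) (¬Isolated⇒1≤pendantCount (lookup ψ j) (tree⇒¬Isolated {lookup ψ j} (trees j)))
    1≤φ : ∀ j → 1 ≤ lookup (Vec.map pendantCount φ) j
    1≤φ j = subst (1 ≤_) (sym (Vecₚ.lookup-map j pendantCount φ)) (¬Isolated⇒1≤pendantCount (lookup φ j) (forest⇒¬Isolated {j} {lookup φ j} (forests j)))
    Σψ = Vec.sum (Vec.map pendantCount ψ)
    Σφ = Vec.sum (Vec.map pendantCount φ)
    Σψ+Σφ≡2q : Σψ + Σφ ≡ q + q
    Σψ+Σφ≡2q = begin
      Σψ + Σφ                                             ≡⟨ cong₂ _+_ (sum-pendantCount ψ) (sum-pendantCount φ) ⟩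
      (mult G e₁ ψ + mult G e₂ ψ) + (mult G e₁ φ + mult G e₂ φ) ≡⟨ +-interchange (mult G e₁ ψ) _ _ _ ⟩
      (mult G e₁ ψ + mult G e₁ φ) + (mult G e₂ ψ + mult G e₂ φ) ≡⟨ cong₂ _+_ (multiplicity e₁) (multiplicity e₂) ⟩
      q + q                                               ∎
      where open ≡-Reasoning
    q≤Σψ = length≤sum (Vec.map pendantCount ψ) 1≤ψ
    q≤Σφ = length≤sum (Vec.map pendantCount φ) 1≤φ
    Σψ≡q : Σψ ≡ q
    Σψ≡q = ≤-antisym (+-cancelʳ-≤ q Σψ q (≤-trans (+-monoʳ-≤ Σψ q≤Σφ) (≤-reflexive Σψ+Σφ≡2q))) q≤Σψ
    Σφ≡q : Σφ ≡ q
    Σφ≡q = +-cancelˡ-≡ q _ _ (trans (cong (_+ Σφ) (sym Σψ≡q)) Σψ+Σφ≡2q)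
    exactlyOne : (Ss : Vec (Subset (m G)) q) → (∀ j → 1 ≤ lookup (Vec.map pendantCount Ss) j) →
                 Vec.sum (Vec.map pendantCount Ss) ≡ q → ∀ j → ExactlyOnePendant (lookup Ss j)
    exactlyOne Ss 1≤ Σ≡q j = pendantCount≡1 (lookup Ss j)
      (trans (sym (Vecₚ.lookup-map j pendantCount Ss)) (sum≡length⇒≡1 (Vec.map pendantCount Ss) 1≤ Σ≡q j))

  apply : Conf G (suc q) → Vec Bool (q + q) → Conf G (suc q)
  apply β w = applyPair β (Vec.take q w) (Vec.drop q w)

  apply-++ : ∀ β wψ wφ → apply β (wψ ++ wφ) ≡ applyPair β wψ wφ
  apply-++ β wψ wφ = uncurry (cong₂ (applyPair β)) (Vecₚ.++-injective (Vec.take q (wψ ++ wφ)) wψ (Vecₚ.take++drop≡id q (wψ ++ wφ)))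

  wordOf : ∀ {K} → Vec (Subset (m G)) K → Vec Bool K
  wordOf = Vec.map λ S → lookup S e₁

  word : Conf G (suc q) → Vec Bool (q + q)
  word (ψ , φ) = wordOf ψ ++ wordOf φ

  wordOf-put : ∀ {K} (Ss : Vec (Subset (m G)) K) ws → wordOf (Vec.zipWith put Ss ws) ≡ ws
  wordOf-put [] [] = refl
  wordOf-put (S ∷ Ss) (x ∷ ws) = cong₂ _∷_ (lookup-set-e₁ S x (not x)) (wordOf-put Ss ws)

  word-apply : ∀ β w → word (apply β w) ≡ w
  word-apply (ψ , φ) w = trans (cong₂ _++_ (wordOf-put ψ (Vec.take q w)) (wordOf-put φ (Vec.drop q w))) (Vecₚ.take++drop≡id q w)

  eraseConf : Conf G (suc q) → Conf G (suc q)
  eraseConf (ψ , φ) = Vec.map erase ψ , Vec.map erase φ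

  map-erase-put : ∀ {K} (Ss : Vec (Subset (m G)) K) ws → Vec.map erase (Vec.zipWith put Ss ws) ≡ Vec.map erase Ss
  map-erase-put [] [] = refl
  map-erase-put (S ∷ Ss) (x ∷ ws) = cong₂ _∷_ (set-set S x (not x) false false) (map-erase-put Ss ws)

  map-erase-erase : ∀ {K} (Ss : Vec (Subset (m G)) K) → Vec.map erase (Vec.map erase Ss) ≡ Vec.map erase Ss
  map-erase-erase [] = refl
  map-erase-erase (S ∷ Ss) = cong₂ _∷_ (set-set S false false false false) (map-erase-erase Ss)

  eraseConf-apply : ∀ β w → eraseConf (apply β w) ≡ eraseConf β
  eraseConf-apply (ψ , φ) w = cong₂ _,_ (map-erase-put ψ (Vec.take q w)) (map-erase-put φ (Vec.drop q w))

  put-erase-wordOf : ∀ {K} (Ss : Vec (Subset (m G)) K) → (∀ j → ExactlyOnePendant (lookup Ss j)) →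
    Vec.zipWith put (Vec.map erase Ss) (wordOf Ss) ≡ Ss
  put-erase-wordOf [] _ = refl
  put-erase-wordOf (S ∷ Ss) exactlyOne = cong₂ _∷_ (put-erase S (exactlyOne Fin.zero)) (put-erase-wordOf Ss (exactlyOne ∘ Fin.suc))

  apply-erase-word : ∀ t → InUnion t → apply (eraseConf t) (word t) ≡ t
  apply-erase-word (ψ , φ) t∈U with InUnion⇒ExactlyOnePendant {ψ} {φ} t∈U
  ... | exactlyOneψ , exactlyOneφ = trans (apply-++ (eraseConf (ψ , φ)) (wordOf ψ) (wordOf φ))
                                          (cong₂ _,_ (put-erase-wordOf ψ exactlyOneψ) (put-erase-wordOf φ exactlyOneφ))

  mult-erase-other : ∀ {K} (Ss : Vec (Subset (m G)) K) {e} → e ≢ e₁ → e ≢ e₂ → mult G e (Vec.map erase Ss) ≡ mult G e Ss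
  mult-erase-other [] _ _ = refl
  mult-erase-other (S ∷ Ss) e≢e₁ e≢e₂ =
    cong₂ _+_ (cong (bit G) (lookup-set-other S false false e≢e₁ e≢e₂)) (mult-erase-other Ss e≢e₁ e≢e₂)

  Base : Conf G (suc q) → Set
  Base β = eraseConf β ≡ β × OffPendantMultiplicities β

  base? : ∀ β → Dec (Base β)
  base? (ψ , φ) = ×ₚ.≡-dec (Vecₚ.≡-dec subset≟) (Vecₚ.≡-dec subset≟) (eraseConf (ψ , φ)) (ψ , φ) ×-dec
    Finₚ.all? (λ e → ¬? (e ≟ e₁) →-dec (¬? (e ≟ e₂) →-dec (mult G e ψ + mult G e φ ℕₚ.≟ q)))
    where subset≟ = Vecₚ.≡-dec Boolₚ._≟_

  allConfs : List (Conf G (suc q))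
  allConfs = List.cartesianProduct (allVecs (allWords (m G)) q) (allVecs (allWords (m G)) q)

  bases : List (Conf G (suc q))
  bases = List.filter base? allConfs

  bases-unique : Unique bases
  bases-unique = Uniqueₚ.filter⁺ base? {xs = allConfs} (Uniqueₚ.cartesianProduct⁺ tuples-unique tuples-unique)
    where tuples-unique = allVecs-unique (allWords-unique (m G)) q

  ∈-bases⁻ : ∀ {β} → β ∈ bases → Base β
  ∈-bases⁻ β∈ = proj₂ (∈-filter⁻ base? {xs = allConfs} β∈)

  Good : Conf G (suc q) → Vec Bool (q + q) → Set
  Good β w = T (admits (treeRestrictions β ++ forestRestrictions β) q w)

  good? : ∀ β → Decidable (Good β)
  good? β w = T? (admits (treeRestrictions β ++ forestRestrictions β) q w)

  apply-injectiveʳ : ∀ β {w w'} → apply β w ≡ apply β w' → w ≡ w'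
  apply-injectiveʳ β {w} {w'} eq = trans (sym (word-apply β w)) (trans (cong word eq) (word-apply β w'))

  apply-injectiveˡ : ∀ {β β' w w'} → β ∈ bases → β' ∈ bases → apply β w ≡ apply β' w' → β ≡ β'
  apply-injectiveˡ {β} {β'} {w} {w'} β∈ β'∈ eq = begin
    β                      ≡⟨ proj₁ (∈-bases⁻ β∈) ⟨
    eraseConf β            ≡⟨ eraseConf-apply β w ⟨
    eraseConf (apply β w)  ≡⟨ cong eraseConf eq ⟩
    eraseConf (apply β' w') ≡⟨ eraseConf-apply β' w' ⟩
    eraseConf β'           ≡⟨ proj₁ (∈-bases⁻ β'∈) ⟩
    β'                     ∎
    where open ≡-Reasoning

  apply-sound : ∀ {β w} → β ∈ bases → Good β w → InGP G (suc q) V Ps (apply β w) ⊎ InGP G (suc q) V Ps' (apply β w)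
  apply-sound {β} {w} β∈ good = InUnion⇒InGP (apply β w)
    (Equivalence.from (InUnion-applyPair β wψ wφ (proj₂ (∈-bases⁻ β∈)))
       (Equivalence.to (T-admits-++ (treeRestrictions β) (forestRestrictions β) q wψ wφ)
          (subst (Good β) (sym (Vecₚ.take++drop≡id q w)) good)))
    where
    wψ = Vec.take q w
    wφ = Vec.drop q w

  apply-complete : ∀ t → InGP G (suc q) V Ps t ⊎ InGP G (suc q) V Ps' t →
    ∃[ β ] ∃[ w ] (β ∈ bases × w ∈ allWords (q + q) × Good β w × t ≡ apply β w)
  apply-complete t@(ψ , φ) t∈U = eraseConf t , word t , β∈ , ∈-allWords (word t) , good , sym (apply-erase-word t t∈)
    where
    t∈ = InGP⇒InUnion t t∈U
    off : OffPendantMultiplicities (eraseConf t)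
    off e e≢e₁ e≢e₂ = trans (cong₂ _+_ (mult-erase-other ψ e≢e₁ e≢e₂) (mult-erase-other φ e≢e₁ e≢e₂)) (proj₁ t∈ e)
    β∈ : eraseConf t ∈ bases
    β∈ = ∈-filter⁺ base? (∈-cartesianProduct⁺ (∈-allVecs ∈-allWords _) (∈-allVecs ∈-allWords _))
                         (cong₂ _,_ (map-erase-erase ψ) (map-erase-erase φ) , off)
    good : Good (eraseConf t) (word t)
    good = Equivalence.from (T-admits-++ (treeRestrictions (eraseConf t)) (forestRestrictions (eraseConf t)) q (wordOf ψ) (wordOf φ))
             (Equivalence.to (InUnion-applyPair (eraseConf t) (wordOf ψ) (wordOf φ) off)
                (subst InUnion (sym (trans (sym (apply-++ (eraseConf t) (wordOf ψ) (wordOf φ))) (apply-erase-word t t∈))) t∈))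

  -- All q tree slots and the i-th forest slot are symmetric under swapping e₁ and e₂.
  p∣#good : ∀ {β} → β ∈ bases → suc q ∣ List.length (List.filter (good? β) (allWords (q + q)))
  p∣#good {β@(ψ , φ)} _ = subst (suc q ∣_) (sym (length-filter-T? _ (allWords (q + q))))
    (p∣count-admits p-prime (treeRestrictions β ++ forestRestrictions β) (begin
      suc q                                                  ≡⟨ +-comm 1 q ⟩
      q + 1                                                  ≤⟨ +-monoʳ-≤ q (#symmetric-lookup (forestRestrictions β) i forest-i-symmetric) ⟩
      q + #symmetric (forestRestrictions β)                  ≡⟨ cong (_+ _) (#symmetric-all (treeRestrictions β) trees-symmetric) ⟨
      #symmetric (treeRestrictions β) + #symmetric (forestRestrictions β) ≡⟨ #symmetric-++ (treeRestrictions β) _ ⟨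
      #symmetric (treeRestrictions β ++ forestRestrictions β) ∎))
    where
    open ≤-Reasoning
    trees-symmetric : ∀ j → Symmetric (lookup (treeRestrictions β) j)
    trees-symmetric j = subst Symmetric (sym (Vecₚ.lookup∘tabulate _ j))
      (restriction-symmetric (λ x → spanningTree? (put (lookup ψ j) x)) (SpanningTree-put (lookup ψ j)))
    forest-i-symmetric : Symmetric (lookup (forestRestrictions β) i)
    forest-i-symmetric = subst Symmetric (sym (Vecₚ.lookup∘tabulate _ i))
      (restriction-symmetric (λ x → eitherForest? i (put (lookup φ i) x)) (EitherForest-put (lookup φ i)))

  partition : PartitionDivBy (suc q) (λ t → InGP G (suc q) V Ps t ⊎ InGP G (suc q) V Ps' t)
  partition = BlockPartition.partition (suc q) _ bases (allWords (q + q)) bases-unique (allWords-unique (q + q))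
    apply good? apply-injectiveʳ apply-injectiveˡ apply-sound apply-complete p∣#good

theorem7p6 : (p : ℕ) → Prime p → (G : Graph) → Connected G ⊤ →
    (V : Subset (n G)) → (c : Fin (n G)) → lookup V c ≡ true → degree G c ≡ 2 →
    (Ps : Vec (Subset (n G)) (p ∸ 1)) →
    (∀ j → ∃[ v ] (lookup V v ≡ true × v ≢ c × lookup (lookup Ps j) v ≡ true)) →
    (∀ j → ∃[ v ] (lookup V v ≡ true × v ≢ c × lookup (lookup Ps j) v ≡ false)) →
    (i : Fin (p ∸ 1)) →
    PartitionDivBy p (λ t → InGP G p V Ps t ⊎ InGP G p V (Ps [ i ]≔ flipAt G c (lookup Ps i)) t)
    × ∃[ k₁ ] ∃[ k₂ ] (HasSize (InGP G p V Ps) k₁ ×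
        HasSize (InGP G p V (Ps [ i ]≔ flipAt G c (lookup Ps i))) k₂ × p ∣ k₁ + k₂)
theorem7p6 zero _ _ _ _ _ _ _ _ _ _ ()
theorem7p6 (suc zero) _ _ _ _ _ _ _ _ _ _ ()
theorem7p6 p@(suc (suc _)) p-prime G _ V c c∈V deg≡2 Ps A∖c B∖c i =
  partition , PartitionDivBy⇒∣sizes partition (inGP? p V Ps) (inGP? p V Ps') InGP-disjoint
  where
  open Connectivity G using (inGP?)
  open Flipped G V c c∈V Ps A∖c B∖c i
  partition : PartitionDivBy p (λ t → InGP G p V Ps t ⊎ InGP G p V Ps' t)
  partition with PendantEdges.degree≡2⇒loop⊎TwoPendants G c deg≡2
  ... | inj₁ (_ , loop) = PartitionDivBy-empty (λ t → Sum.[ loop⇒¬InGP G loop V Ps t , loop⇒¬InGP G loop V Ps' t ])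
  ... | inj₂ pendants = TwoPendantCase.partition G V c c∈V p-prime Ps A∖c B∖c i pendants
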